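{- For every integer $n\ge 1$, \[ |\mathfrak D^1_{2n}(2341,1423)|=\frac{1}{\sqrt{17}}\left(\left(\frac{3+\sqrt{17}}{2}\right)^n-\left(\frac{3-\sqrt{17}}{2}\right)^n\right), \] and this equals the integer closest to $\frac{1}{\sqrt{17}}\left(\frac{3+\sqrt{17}}{2}\right)^n$.
   Context: A permutation $\sigma\in\mathfrak S_m$ contains a pattern $\tau\in\mathfrak S_k$ if $\sigma$ has a subsequence $(\sigma(i_1),\dots,\sigma(i_k))$, $i_1<\dots<i_k$, order-isomorphic to $\tau$; otherwise $\sigma$ avoids $\tau$. A Dumont permutation of the first kind of length $2n$ is a permutation $\pi\in\mathfrak S_{2n}$ such that for every $i$: if $\pi(i)$ is even then $i<2n$ and $\pi(i)>\pi(i+1)$; if $\pi(i)$ is odd then $i=2n$ or $\pi(i)<\pi(i+1)$. $\mathfrak D^1_{2n}(T)$ denotes the set of such permutations avoiding every pattern in $T$. -}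

module Defs where

open import Data.Nat as ℕ using (ℕ; zero; suc)
open import Data.Nat.Divisibility using (_∣_)
open import Data.Integer as ℤ using (ℤ; +_; 0ℤ)
open import Data.Fin as Fin using (Fin; toℕ; fromℕ<)
open import Data.Vec using (Vec; lookup; _∷_; [])
open import Data.Product using (Σ; ∃; _×_; _,_)
open import Data.Sum using (_⊎_)
open import Relation.Nullary using (¬_)
open import Relation.Binary.PropositionalEquality using (_≡_)

-- Permutations of length m, stored in one-line notation as a vector of
-- values in Fin m (value k : Fin m stands for the integer toℕ k + 1).

IsPerm : {m : ℕ} → Vec (Fin m) m → Set
IsPerm {m} π = ∀ (i j : Fin m) → lookup π i ≡ lookup π j → i ≡ j

val : {m : ℕ} → Vec (Fin m) m → Fin m → ℕ
val π i = suc (toℕ (lookup π i))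

-- Dumont permutations of the first kind (π ∈ 𝔖_m with m = 2n):
-- if π(i) is even then i < m and π(i) > π(i+1);
-- if π(i) is odd then i = m or π(i) < π(i+1).
-- (positions are 0-indexed here: position i is last iff suc (toℕ i) ≡ m)
IsDumont1 : {m : ℕ} → Vec (Fin m) m → Set
IsDumont1 {m} π = ∀ (i : Fin m) →
    (2 ∣ val π i → Σ (suc (toℕ i) ℕ.< m) λ h → val π (fromℕ< h) ℕ.< val π i)
  × (¬ (2 ∣ val π i) → (suc (toℕ i) ≡ m) ⊎ Σ (suc (toℕ i) ℕ.< m) λ h → val π i ℕ.< val π (fromℕ< h))

Contains : {m k : ℕ} → Vec (Fin m) m → Vec (Fin k) k → Set
Contains {m} {k} σ τ = Σ (Fin k → Fin m) λ f →
    (∀ a b → a Fin.< b → f a Fin.< f b)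
  × (∀ a b → (lookup τ a Fin.< lookup τ b → lookup σ (f a) Fin.< lookup σ (f b))
           × (lookup σ (f a) Fin.< lookup σ (f b) → lookup τ a Fin.< lookup τ b))

Avoids : {m k : ℕ} → Vec (Fin m) m → Vec (Fin k) k → Set
Avoids σ τ = ¬ Contains σ τ

-- the patterns 2341 and 1423 (values shifted down by one)
p2341 : Vec (Fin 4) 4
p2341 = Fin.suc Fin.zero ∷ Fin.suc (Fin.suc Fin.zero) ∷ Fin.suc (Fin.suc (Fin.suc Fin.zero)) ∷ Fin.zero ∷ []

p1423 : Vec (Fin 4) 4
p1423 = Fin.zero ∷ Fin.suc (Fin.suc (Fin.suc Fin.zero)) ∷ Fin.suc Fin.zero ∷ Fin.suc (Fin.suc Fin.zero) ∷ []

InD : (n : ℕ) → Vec (Fin (2 ℕ.* n)) (2 ℕ.* n) → Set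
InD n π = IsPerm π × IsDumont1 π × Avoids π p2341 × Avoids π p1423

-- The ring ℤ[√17] ⊂ ℝ: the pair (p , q) denotes p + q√17.

ℤ√17 : Set
ℤ√17 = ℤ × ℤ

infixl 6 _⊕_ _⊖_
infixl 7 _⊗_

_⊕_ : ℤ√17 → ℤ√17 → ℤ√17
(a , b) ⊕ (c , d) = (a ℤ.+ c , b ℤ.+ d)

_⊖_ : ℤ√17 → ℤ√17 → ℤ√17
(a , b) ⊖ (c , d) = (a ℤ.- c , b ℤ.- d)

_⊗_ : ℤ√17 → ℤ√17 → ℤ√17
(a , b) ⊗ (c , d) = (a ℤ.* c ℤ.+ + 17 ℤ.* b ℤ.* d , a ℤ.* d ℤ.+ b ℤ.* c)

ι : ℤ → ℤ√17
ι a = (a , 0ℤ)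

√17 : ℤ√17
√17 = (0ℤ , + 1)

_^′_ : ℤ√17 → ℕ → ℤ√17
x ^′ zero = ι (+ 1)
x ^′ suc n = x ⊗ (x ^′ n)

-- p + q√17 > 0 as a real number (sign rule for ℤ[√17])
Pos : ℤ√17 → Set
Pos (p , q) =
    (0ℤ ℤ.≤ p × 0ℤ ℤ.≤ q × ¬ (p ≡ 0ℤ × q ≡ 0ℤ))
  ⊎ (0ℤ ℤ.< p × q ℤ.< 0ℤ × + 17 ℤ.* q ℤ.* q ℤ.< p ℤ.* p)
  ⊎ (p ℤ.< 0ℤ × 0ℤ ℤ.< q × p ℤ.* p ℤ.< + 17 ℤ.* q ℤ.* q)

AbsLt : ℤ√17 → ℤ√17 → Set
AbsLt x y = Pos (y ⊖ x) × Pos (y ⊕ x)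

-- Read a permutation as the word of its values. For even k, the odd value k + 1 of a word in
-- 𝔇¹_{k+2}(2341,1423) is either last or followed by k + 2, and avoiding 2341 and 1423 leaves exactly five
-- shapes: (k+1)(k+2)σ, (k+2)σ(k+1) and σ(k+2)(k+1) with σ ∈ 𝔇¹_k, and τ(k+1)(k+2)k(k−1) and
-- k(k−1)(k+2)τ(k+1) with τ ∈ 𝔇¹_{k−2} nonempty. So c₁ = 1, c₂ = 3 and c_{n+2} = 3c_{n+1} + 2c_n, whose
-- characteristic roots are (3 ± √17)/2. Writing (3 + √17)ⁿ = pₙ + sₙ√17, the same recurrence gives
-- 2sₙ = 2ⁿcₙ, which is the closed formula. Then 2(3 + √17)ⁿ − 2ⁿ⁺¹cₙ√17 = 2(3 − √17)ⁿ, and it has absolute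
-- value below 2ⁿ√17 because the norm pₙ² − 17sₙ² = (−8)ⁿ is small: 8ⁿ against sₙ² ≥ 16ⁿ⁻¹.
module Submission where

open import Defs
open import Data.Nat using (ℕ; _≥_; _*_; _^_)
open import Data.Integer using (+_; -[1+_])
open import Data.Fin using (Fin)
open import Data.Vec using (Vec)
open import Data.List using (List; length)
open import Data.List.Membership.Propositional using (_∈_)
open import Data.List.Relation.Unary.Unique.Propositional using (Unique)
open import Data.Product using (Σ; _×_; _,_)
open import Function.Bundles using (_⇔_)
open import Relation.Binary.PropositionalEquality using (_≡_)

open import Data.Bool using (T)
open import Data.Empty using (⊥)
open import Data.Unit using (⊤; tt)
open import Data.Product using (proj₁; proj₂; ∃; ∃₂; map₂; swap)
import Data.Product as Prod
open import Data.Sum using (_⊎_; inj₁; inj₂; [_,_]′) renaming (swap to swap⊎)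
import Data.Sum as Sum
open import Function using (_∘_; flip; id)
open import Function.Bundles using (mk⇔; Equivalence)
open import Relation.Nullary using (¬_; Dec; yes; no; contradiction)
open import Relation.Nullary.Decidable using (True; toWitness; from-yes; _→-dec_)
open import Relation.Binary.Definitions using (tri<; tri≈; tri>)
open import Relation.Binary.PropositionalEquality
  using (_≢_; refl; sym; trans; cong; cong₂; subst; subst₂; ≢-sym; module ≡-Reasoning)

open import Data.Nat using (zero; suc; _+_; _∸_; _<_; _≤_; _>_; _<ᵇ_; z≤n; s≤s; z<s; _≟_; _≤?_)
open import Data.Nat.Properties
open import Data.Nat.Divisibility using (_∣_; _∣?_; ∣-refl; _∣0; ∣1⇒≡1; ∣m∣n⇒∣m+n; ∣m+n∣m⇒∣n)
open import Data.Nat.ListAction using (sum)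
open import Data.Nat.Tactic.RingSolver using (solve-∀)
open import Data.Integer as ℤ using (ℤ; 0ℤ)
import Data.Integer.Properties as ZP
import Data.Integer.Tactic.RingSolver as ZR
open import Data.Fin using (toℕ; fromℕ<)
import Data.Fin as Fin
open import Data.Fin.Patterns using (0F; 1F; 2F; 3F)
open import Data.Fin.Properties using (toℕ-injective; toℕ-fromℕ<; toℕ<n; all?)
import Data.Vec as Vec

open import Data.List using ([]; _∷_; _++_; [_]; map; tabulate; concat)
import Data.List as List
open import Data.List.Properties
  using (length-++; length-map; length-tabulate; tabulate-cong; ++-assoc; ++-identityʳ; ++-conicalʳ; ++-cancelʳ
        ; ∷-injectiveˡ; ∷-injectiveʳ)
open import Data.List.Membership.DecPropositional _≟_ using (_∈?_)
open import Data.List.Membership.Propositional.Properties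
  using (∈-∃++; ∈-++⁻; ∈-++⁺ˡ; ∈-++⁺ʳ; ∈-map⁺; ∈-map⁻; ∈-concat⁺; ∈-tabulate⁺)
open import Data.List.Relation.Unary.Any using (Any; here; there)
open import Data.List.Relation.Unary.All as All using (All; []; _∷_)
import Data.List.Relation.Unary.All.Properties as Allₚ
open import Data.List.Relation.Unary.AllPairs using (AllPairs; []; _∷_)
import Data.List.Relation.Unary.Unique.Propositional.Properties as Unique
open import Data.List.Relation.Binary.Disjoint.Propositional using (Disjoint)
open import Data.List.Relation.Binary.Sublist.Propositional
  using (_⊆_; []; _∷_; _∷ʳ_; ⊆-refl; ⊆-trans; from∈)
  renaming (lookup to ∈-⊆)
open import Data.List.Relation.Binary.Sublist.Propositional.Properties
  using (++⁺; ++⁺ˡ; ++⁺ʳ; length-mono-≤; to-≋; All-resp-⊆; []⊆-universal)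
open import Data.List.Relation.Binary.Equality.Propositional using (≋⇒≡)

private
  variable
    k m x y : ℕ
    r s t u v w α β σ τ : List ℕ

private
  ∈₀ : x ∈ x ∷ w
  ∈₀ = here refl
  ∈₁ : y ∈ x ∷ y ∷ w
  ∈₁ = there ∈₀
  ∈₂ : ∀ {z} → z ∈ x ∷ y ∷ z ∷ w
  ∈₂ = there ∈₁

≤∧≢⇒≤pred : x ≤ suc m → x ≢ suc m → x ≤ m
≤∧≢⇒≤pred x≤ x≢ = m<1+n⇒m≤n (≤∧≢⇒< x≤ x≢)

≮∧≢⇒> : ¬ x < y → x ≢ y → y < x
≮∧≢⇒> x≮y x≢y = ≤∧≢⇒< (≮⇒≥ x≮y) (≢-sym x≢y)

length-++-∷ : ∀ u → length (u ++ x ∷ v) ≡ suc (length (u ++ v))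
length-++-∷ [] = refl
length-++-∷ (_ ∷ u) = cong suc (length-++-∷ u)

length-++-≡ : ∀ (u v : List ℕ) → length u ≡ k → length (u ++ v) ≡ length v + k
length-++-≡ u v refl = trans (length-++ u) (+-comm (length u) (length v))

length-++-cancel : ∀ (u v : List ℕ) → length (u ++ v) ≡ length v + k → length u ≡ k
length-++-cancel u v eq = +-cancelˡ-≡ (length v) _ _ (trans (+-comm (length v) (length u)) (trans (sym (length-++ u)) eq))

≢[]⇒∈ : w ≢ [] → ∃ (_∈ w)
≢[]⇒∈ {[]} w≢[] = contradiction refl w≢[]
≢[]⇒∈ {x ∷ _} _ = x , ∈₀

≢[]⇒length>0 : w ≢ [] → 0 < length w
≢[]⇒length>0 {[]} w≢[] = contradiction refl w≢[]
≢[]⇒length>0 {_ ∷ _} _ = z<s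

∷ʳ≢[] : ∀ u → u ++ [ x ] ≢ []
∷ʳ≢[] u eq with ++-conicalʳ u _ eq
... | ()

⊆-++-split : ∀ u → s ⊆ u ++ v → ∃₂ λ s₁ s₂ → s ≡ s₁ ++ s₂ × s₁ ⊆ u × s₂ ⊆ v
⊆-++-split [] p = [] , _ , refl , [] , p
⊆-++-split (x ∷ u) (_ ∷ʳ p) with ⊆-++-split u p
... | s₁ , s₂ , refl , p₁ , p₂ = s₁ , s₂ , refl , x ∷ʳ p₁ , p₂
⊆-++-split (x ∷ u) (refl ∷ p) with ⊆-++-split u p
... | s₁ , s₂ , refl , p₁ , p₂ = x ∷ s₁ , s₂ , refl , refl ∷ p₁ , p₂

⊆-length-≡ : s ⊆ w → length s ≡ length w → s ≡ w
⊆-length-≡ p eq = ≋⇒≡ (to-≋ eq p)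

Unique-⊆ : s ⊆ w → Unique w → Unique s
Unique-⊆ [] _ = []
Unique-⊆ (_ ∷ʳ p) (_ ∷ u) = Unique-⊆ p u
Unique-⊆ (refl ∷ p) (x∉ ∷ u) = All-resp-⊆ p x∉ ∷ Unique-⊆ p u

Unique-pair : Unique w → x ∷ y ∷ [] ⊆ w → x ≢ y
Unique-pair u p with Unique-⊆ p u
... | (x≢y ∷ []) ∷ _ = x≢y

Unique-++-≢ : ∀ u → Unique (u ++ v) → x ∈ u → y ∈ v → x ≢ y
Unique-++-≢ _ uw x∈u y∈v = Unique-pair uw (++⁺ (from∈ x∈u) (from∈ y∈v))

AllPairs-⊆ : ∀ {R : ℕ → ℕ → Set} → (∀ {a b} → a ∷ b ∷ [] ⊆ w → R a b) → AllPairs R w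
AllPairs-⊆ {[]} _ = []
AllPairs-⊆ {x ∷ w} h = All.tabulate (λ y∈w → h (refl ∷ from∈ y∈w)) ∷ AllPairs-⊆ λ p → h (x ∷ʳ p)

length-concat : ∀ {A : Set} (xss : List (List A)) → length (concat xss) ≡ sum (map length xss)
length-concat [] = refl
length-concat (xs ∷ xss) = trans (length-++ xs) (cong (λ n → length xs + n) (length-concat xss))

map-Disjoint : ∀ {A B : Set} {xs ys : List A} {f g : A → B} →
               (∀ {a b} → a ∈ xs → b ∈ ys → f a ≢ g b) → Disjoint (map f xs) (map g ys)
map-Disjoint {f = f} {g} h (i , j) with ∈-map⁻ f i | ∈-map⁻ g j
... | _ , a∈ , refl | _ , b∈ , eq = h a∈ b∈ eq

first final third : List ℕ → ℕ
first [] = 0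
first (x ∷ _) = x
final [] = 0
final (x ∷ []) = x
final (_ ∷ y ∷ w) = final (y ∷ w)
third (_ ∷ _ ∷ x ∷ _) = x
third _ = 0

first-++ : All (_≤ m) σ → σ ≢ [] → first (σ ++ t) ≤ m
first-++ {σ = []} _ σ≢[] = contradiction refl σ≢[]
first-++ {σ = _ ∷ _} (x≤m ∷ _) _ = x≤m

final-++ : ∀ u → v ≢ [] → final (u ++ v) ≡ final v
final-++ [] _ = refl
final-++ {[]} (_ ∷ []) v≢[] = contradiction refl v≢[]
final-++ {_ ∷ _} (_ ∷ []) _ = refl
final-++ (_ ∷ x ∷ u) v≢[] = final-++ (x ∷ u) v≢[]

third-++ : All (_≤ m) σ → 3 ≤ length σ → third (σ ++ t) ≤ m
third-++ (_ ∷ _ ∷ x≤m ∷ _) _ = x≤m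
third-++ [] ()
third-++ (_ ∷ []) (s≤s ())
third-++ (_ ∷ _ ∷ []) (s≤s (s≤s ()))

-- Pattern occurrences in words

Pattern : Set₁
Pattern = List ℕ → Set

Occurs : Pattern → List ℕ → Set
Occurs P w = ∃ λ s → s ⊆ w × P s

Occurs-mono : ∀ {P} → u ⊆ w → Occurs P u → Occurs P w
Occurs-mono u⊆w (s , s⊆u , p) = s , ⊆-trans s⊆u u⊆w , p

P2341 P1423 P312 P123 : Pattern
P2341 (a ∷ b ∷ c ∷ d ∷ []) = d < a × a < b × b < c
P2341 _ = ⊥
P1423 (a ∷ b ∷ c ∷ d ∷ []) = a < c × c < d × d < b
P1423 _ = ⊥
P312 (a ∷ b ∷ c ∷ []) = b < c × c < a
P312 _ = ⊥
P123 (a ∷ b ∷ c ∷ []) = a < b × b < c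
P123 _ = ⊥

Avoiding : List ℕ → Set
Avoiding w = ¬ Occurs P2341 w × ¬ Occurs P1423 w

Avoiding-⊆ : u ⊆ w → Avoiding w → Avoiding u
Avoiding-⊆ u⊆w (a₁ , a₂) = a₁ ∘ Occurs-mono u⊆w , a₂ ∘ Occurs-mono u⊆w

¬Occurs-short : ∀ {P} n → (∀ {s} → P s → length s ≡ n) → length w < n → ¬ Occurs P w
¬Occurs-short n len w<n (s , s⊆w , p) = <⇒≱ w<n (subst (_≤ _) (len p) (length-mono-≤ s⊆w))

P2341-length : P2341 s → length s ≡ 4
P2341-length {_ ∷ _ ∷ _ ∷ _ ∷ []} _ = refl

P1423-length : P1423 s → length s ≡ 4
P1423-length {_ ∷ _ ∷ _ ∷ _ ∷ []} _ = refl

P312-length : P312 s → length s ≡ 3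
P312-length {_ ∷ _ ∷ _ ∷ []} _ = refl

P123-length : P123 s → length s ≡ 3
P123-length {_ ∷ _ ∷ _ ∷ []} _ = refl

Avoiding-short : {True (length w <? 4)} → Avoiding w
Avoiding-short {w} {w<4} =
  ¬Occurs-short 4 P2341-length (toWitness w<4) , ¬Occurs-short 4 P1423-length (toWitness w<4)

¬P312-short : {True (length w <? 3)} → ¬ Occurs P312 w
¬P312-short {w} {w<3} = ¬Occurs-short 3 P312-length (toWitness w<3)

¬P123-short : {True (length w <? 3)} → ¬ Occurs P123 w
¬P123-short {w} {w<3} = ¬Occurs-short 3 P123-length (toWitness w<3)

Occurs-∷ʳ : ∀ {P} w → Occurs P (w ++ [ x ]) → Occurs P w ⊎ ∃ λ s → s ⊆ w × P (s ++ [ x ])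
Occurs-∷ʳ {P = P} w (s , p , o) with ⊆-++-split w p
... | s₁ , [] , refl , p₁ , _ = inj₁ (s₁ , p₁ , subst P (++-identityʳ s₁) o)
... | s₁ , _ ∷ [] , refl , p₁ , refl ∷ [] = inj₂ (s₁ , p₁ , o)

infix 4 _≺_

_≺_ : List ℕ → List ℕ → Set
u ≺ v = ∀ {x y} → x ∈ u → y ∈ v → x < y

≺⇒Disjoint : u ≺ v → Disjoint u v
≺⇒Disjoint u≺v (x∈u , x∈v) = <-irrefl refl (u≺v x∈u x∈v)

bounded-≺ : All (_≤ k) u → All (k <_) v → u ≺ v
bounded-≺ u≤k k<v x∈u y∈v = ≤-<-trans (All.lookup u≤k x∈u) (All.lookup k<v y∈v)

Unique-++-≺ : Unique u → Unique v → u ≺ v → Unique (u ++ v)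
Unique-++-≺ uu uv u≺v = Unique.++⁺ uu uv (≺⇒Disjoint u≺v)

Unique-++-≻ : Unique u → Unique v → v ≺ u → Unique (u ++ v)
Unique-++-≻ uu uv v≺u = Unique.++⁺ uu uv (≺⇒Disjoint v≺u ∘ swap)

-- If u ≺ v then u ++ v is the direct sum of u and v and v ++ u their skew sum. Since 2341 = 123 ⊖ 1 and
-- 1423 = 1 ⊕ 312, an occurrence meeting both summands can only split in these ways.
P2341-direct : u ≺ v → Occurs P2341 (u ++ v) → Occurs P2341 u ⊎ Occurs P2341 v
P2341-direct {u} u≺v (_ ∷ _ ∷ _ ∷ _ ∷ [] , p , o@(d<a , _)) with ⊆-++-split u p
... | [] , _ , refl , _ , p₂ = inj₂ (_ , p₂ , o)
... | _ ∷ [] , _ , refl , p₁ , p₂ = contradiction (u≺v (∈-⊆ p₁ ∈₀) (∈-⊆ p₂ ∈₂)) (<-asym d<a)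
... | _ ∷ _ ∷ [] , _ , refl , p₁ , p₂ = contradiction (u≺v (∈-⊆ p₁ ∈₀) (∈-⊆ p₂ ∈₁)) (<-asym d<a)
... | _ ∷ _ ∷ _ ∷ [] , _ , refl , p₁ , p₂ = contradiction (u≺v (∈-⊆ p₁ ∈₀) (∈-⊆ p₂ ∈₀)) (<-asym d<a)
... | _ ∷ _ ∷ _ ∷ _ ∷ [] , _ , refl , p₁ , _ = inj₁ (_ , p₁ , o)

P1423-direct : u ≺ v → Occurs P1423 (u ++ v) → Occurs P1423 u ⊎ Occurs P1423 v ⊎ Occurs P312 v
P1423-direct {u} u≺v (_ ∷ _ ∷ _ ∷ _ ∷ [] , p , o@(_ , c<d , d<b)) with ⊆-++-split u p
... | [] , _ , refl , _ , p₂ = inj₂ (inj₁ (_ , p₂ , o))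
... | _ ∷ [] , _ , refl , _ , p₂ = inj₂ (inj₂ (_ , p₂ , c<d , d<b))
... | _ ∷ _ ∷ [] , _ , refl , p₁ , p₂ =
  contradiction (u≺v (∈-⊆ p₁ ∈₁) (∈-⊆ p₂ ∈₀)) (<-asym (<-trans c<d d<b))
... | _ ∷ _ ∷ _ ∷ [] , _ , refl , p₁ , p₂ = contradiction (u≺v (∈-⊆ p₁ ∈₁) (∈-⊆ p₂ ∈₀)) (<-asym d<b)
... | _ ∷ _ ∷ _ ∷ _ ∷ [] , _ , refl , p₁ , _ = inj₁ (_ , p₁ , o)

P2341-skew : v ≺ u → Occurs P2341 (u ++ v) → Occurs P2341 u ⊎ Occurs P2341 v ⊎ Occurs P123 u
P2341-skew {u = u} v≺u (_ ∷ _ ∷ _ ∷ _ ∷ [] , p , o@(_ , a<b , b<c)) with ⊆-++-split u p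
... | [] , _ , refl , _ , p₂ = inj₂ (inj₁ (_ , p₂ , o))
... | _ ∷ [] , _ , refl , p₁ , p₂ = contradiction (v≺u (∈-⊆ p₂ ∈₀) (∈-⊆ p₁ ∈₀)) (<-asym a<b)
... | _ ∷ _ ∷ [] , _ , refl , p₁ , p₂ = contradiction (v≺u (∈-⊆ p₂ ∈₀) (∈-⊆ p₁ ∈₁)) (<-asym b<c)
... | _ ∷ _ ∷ _ ∷ [] , _ , refl , p₁ , _ = inj₂ (inj₂ (_ , p₁ , a<b , b<c))
... | _ ∷ _ ∷ _ ∷ _ ∷ [] , _ , refl , p₁ , _ = inj₁ (_ , p₁ , o)

P1423-skew : v ≺ u → Occurs P1423 (u ++ v) → Occurs P1423 u ⊎ Occurs P1423 v
P1423-skew {u = u} v≺u (_ ∷ _ ∷ _ ∷ _ ∷ [] , p , o@(a<c , c<d , _)) with ⊆-++-split u p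
... | [] , _ , refl , _ , p₂ = inj₂ (_ , p₂ , o)
... | _ ∷ [] , _ , refl , p₁ , p₂ = contradiction (v≺u (∈-⊆ p₂ ∈₁) (∈-⊆ p₁ ∈₀)) (<-asym a<c)
... | _ ∷ _ ∷ [] , _ , refl , p₁ , p₂ = contradiction (v≺u (∈-⊆ p₂ ∈₀) (∈-⊆ p₁ ∈₀)) (<-asym a<c)
... | _ ∷ _ ∷ _ ∷ [] , _ , refl , p₁ , p₂ = contradiction (v≺u (∈-⊆ p₂ ∈₀) (∈-⊆ p₁ ∈₂)) (<-asym c<d)
... | _ ∷ _ ∷ _ ∷ _ ∷ [] , _ , refl , p₁ , _ = inj₁ (_ , p₁ , o)

P312-skew : v ≺ u → Occurs P312 (u ++ v) → Occurs P312 u ⊎ Occurs P312 v ⊎ ∃₂ λ b c → b ∷ c ∷ [] ⊆ v × b < c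
P312-skew {u = u} v≺u (_ ∷ _ ∷ _ ∷ [] , p , o@(b<c , _)) with ⊆-++-split u p
... | [] , _ , refl , _ , p₂ = inj₂ (inj₁ (_ , p₂ , o))
... | _ ∷ [] , _ , refl , _ , p₂ = inj₂ (inj₂ (_ , _ , p₂ , b<c))
... | _ ∷ _ ∷ [] , _ , refl , p₁ , p₂ = contradiction (v≺u (∈-⊆ p₂ ∈₀) (∈-⊆ p₁ ∈₁)) (<-asym b<c)
... | _ ∷ _ ∷ _ ∷ [] , _ , refl , p₁ , _ = inj₁ (_ , p₁ , o)

Avoiding-direct : u ≺ v → Avoiding u → Avoiding v → ¬ Occurs P312 v → Avoiding (u ++ v)
Avoiding-direct u≺v (u₁ , u₂) (v₁ , v₂) v₃ =
  [ u₁ , v₁ ]′ ∘ P2341-direct u≺v , [ u₂ , [ v₂ , v₃ ]′ ]′ ∘ P1423-direct u≺v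

Avoiding-skew : v ≺ u → Avoiding u → Avoiding v → ¬ Occurs P123 u → Avoiding (u ++ v)
Avoiding-skew v≺u (u₁ , u₂) (v₁ , v₂) u₃ =
  [ u₁ , [ v₁ , u₃ ]′ ]′ ∘ P2341-skew v≺u , [ u₂ , v₂ ]′ ∘ P1423-skew v≺u

-- Dumont words

Even Odd : ℕ → Set
Even x = 2 ∣ x
Odd x = ¬ 2 ∣ x

Even⇒Odd-suc : Even k → Odd (suc k)
Even⇒Odd-suc {k} 2∣k 2∣1+k = contradiction (∣1⇒≡1 (∣m+n∣m⇒∣n (subst (2 ∣_) (+-comm 1 k) 2∣1+k) 2∣k)) λ ()

Even-+2 : Even k → Even (2 + k)
Even-+2 = ∣m∣n⇒∣m+n ∣-refl

Even-+2⁻ : Even (2 + k) → Even k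
Even-+2⁻ 2∣2+k = ∣m+n∣m⇒∣n 2∣2+k ∣-refl

DumontStep : ℕ → ℕ → Set
DumontStep x y = (Even x → y < x) × (Odd x → x < y)

Dumont : List ℕ → Set
Dumont [] = ⊤
Dumont (x ∷ []) = Odd x
Dumont (x ∷ y ∷ w) = DumontStep x y × Dumont (y ∷ w)

DumontStep-even : Even x → y < x → DumontStep x y
DumontStep-even ev y<x = (λ _ → y<x) , contradiction ev

DumontStep-odd : Odd x → x < y → DumontStep x y
DumontStep-odd od x<y = flip contradiction od , λ _ → x<y

DumontStep-descent⇒Even : DumontStep x y → y < x → Even x
DumontStep-descent⇒Even {x} (_ , odd⇒x<y) y<x with 2 ∣? x
... | yes ev = ev
... | no od = contradiction (odd⇒x<y od) (<-asym y<x)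

DumontStep-ascent⇒Odd : DumontStep x y → x < y → Odd x
DumontStep-ascent⇒Odd (even⇒y<x , _) x<y ev = <-asym x<y (even⇒y<x ev)

Dumont-tail : Dumont (x ∷ w) → Dumont w
Dumont-tail {w = []} _ = tt
Dumont-tail {w = _ ∷ _} (_ , d) = d

Dumont-++⁻ʳ : ∀ u → Dumont (u ++ v) → Dumont v
Dumont-++⁻ʳ [] d = d
Dumont-++⁻ʳ (_ ∷ u) d = Dumont-++⁻ʳ u (Dumont-tail d)

Dumont-++⁻ˡ : ∀ u → Dumont (u ++ y ∷ v) → All (_< y) u → Dumont u
Dumont-++⁻ˡ [] _ _ = tt
Dumont-++⁻ˡ (_ ∷ []) (step , _) (x<y ∷ _) = DumontStep-ascent⇒Odd step x<y
Dumont-++⁻ˡ (_ ∷ x ∷ u) (step , d) (_ ∷ u<y) = step , Dumont-++⁻ˡ (x ∷ u) d u<y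

Dumont-++⁺ : ∀ u → Dumont u → All (_< y) u → Dumont (y ∷ v) → Dumont (u ++ y ∷ v)
Dumont-++⁺ [] _ _ dv = dv
Dumont-++⁺ (_ ∷ []) od (x<y ∷ _) dv = DumontStep-odd od x<y , dv
Dumont-++⁺ (_ ∷ x ∷ u) (step , d) (_ ∷ u<y) dv = step , Dumont-++⁺ (x ∷ u) d u<y dv

Dumont-∷-even : Even x → w ≢ [] → All (_< x) w → Dumont w → Dumont (x ∷ w)
Dumont-∷-even {w = []} _ w≢[] _ _ = contradiction refl w≢[]
Dumont-∷-even {w = _ ∷ _} ev _ (y<x ∷ _) d = DumontStep-even ev y<x , d

InRange : ℕ → List ℕ → Set
InRange m = All (λ x → 0 < x × x ≤ m)

InRange-pred : InRange (suc m) w → (∀ {x} → x ∈ w → x ≢ suc m) → InRange m w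
InRange-pred r ≢m+1 = All.tabulate λ i → map₂ (λ x≤ → ≤∧≢⇒≤pred x≤ (≢m+1 i)) (All.lookup r i)

pigeonhole : ∀ m → Unique w → InRange m w → length w ≤ m
pigeonhole {[]} _ _ _ = z≤n
pigeonhole {_ ∷ _} zero _ ((0<x , x≤0) ∷ _) = contradiction x≤0 (<⇒≱ 0<x)
pigeonhole {w} (suc m) u r with suc m ∈? w
... | no m+1∉w = m≤n⇒m≤1+n (pigeonhole m u (InRange-pred r λ { i refl → m+1∉w i }))
... | yes m+1∈w with ∈-∃++ m+1∈w
...   | α , β , refl = subst (_≤ suc m) (sym (length-++-∷ α)) (s≤s (pigeonhole m (Unique-⊆ α⊆ u) r′))
  where
  α⊆ : α ++ β ⊆ α ++ suc m ∷ β
  α⊆ = ++⁺ ⊆-refl (_ ∷ʳ ⊆-refl)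
  ≢m+1 : x ∈ α ++ β → x ≢ suc m
  ≢m+1 i with ∈-++⁻ α i
  ... | inj₁ i∈α = Unique-pair u (++⁺ (from∈ i∈α) (refl ∷ []⊆-universal β))
  ... | inj₂ i∈β = ≢-sym (Unique-pair u (++⁺ˡ α (refl ∷ from∈ i∈β)))
  r′ : InRange m (α ++ β)
  r′ = InRange-pred (All-resp-⊆ α⊆ r) ≢m+1

full-∈ : Unique w → InRange m w → length w ≡ m → 0 < x → x ≤ m → x ∈ w
full-∈ {w} {m} {x} u r len 0<x x≤m with x ∈? w
... | yes x∈w = x∈w
... | no x∉w = contradiction (subst (λ n → suc n ≤ m) len (pigeonhole m (Allₚ.¬Any⇒All¬ w x∉w ∷ u) ((0<x , x≤m) ∷ r)))
                            (<⇒≱ ≤-refl)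

InRange⇒≤ : InRange m w → All (_≤ m) w
InRange⇒≤ = All.map proj₂

InRange-+ : ∀ i → InRange m w → InRange (i + m) w
InRange-+ i = All.map (map₂ (m≤n⇒m≤o+n i))

InRange-restrict : InRange m w → u ⊆ w → All (_≤ k) u → InRange k u
InRange-restrict r p u≤k = All.zipWith (λ ((0<x , _) , x≤k) → 0<x , x≤k) (All-resp-⊆ p r , u≤k)

-- 𝔇 m w: w is the word π(1) … π(m) of a permutation π ∈ 𝔇¹_m(2341,1423).
record 𝔇 (m : ℕ) (w : List ℕ) : Set where
  field
    length≡ : length w ≡ m
    inRange : InRange m w
    unique : Unique w
    dumont : Dumont w
    avoiding : Avoiding w
open 𝔇

𝔇-∈ : 𝔇 m w → 0 < x → x ≤ m → x ∈ w
𝔇-∈ g = full-∈ (unique g) (inRange g) (length≡ g)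

𝔇-restrict : 𝔇 m w → u ⊆ w → All (_≤ k) u → length u ≡ k → Dumont u → 𝔇 k u
𝔇-restrict g p u≤k len d = record
  { length≡ = len
  ; inRange = InRange-restrict (inRange g) p u≤k
  ; unique = Unique-⊆ p (unique g)
  ; dumont = d
  ; avoiding = Avoiding-⊆ p (avoiding g)
  }

𝔇-restrict-∈ : 𝔇 m w → u ⊆ w → All (_≤ k) u → length u ≡ k → 0 < x → x ≤ k → x ∈ u
𝔇-restrict-∈ g p u≤k len = full-∈ (Unique-⊆ p (unique g)) (InRange-restrict (inRange g) p u≤k) len

𝔇-nonempty : 𝔇 (suc m) w → w ≢ []
𝔇-nonempty g refl with length≡ g
... | ()

𝔇₀-empty : 𝔇 0 σ → σ ≡ []
𝔇₀-empty {[]} _ = refl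
𝔇₀-empty {_ ∷ _} g with length≡ g
... | ()

-- The five constructions

extA extB extC : ℕ → List ℕ → List ℕ
extA k σ = 1 + k ∷ 2 + k ∷ σ
extB k σ = 2 + k ∷ σ ++ [ 1 + k ]
extC k σ = σ ++ 2 + k ∷ 1 + k ∷ []

extD extE : ℕ → List ℕ → List ℕ
extD j τ = τ ++ 3 + j ∷ 4 + j ∷ 2 + j ∷ 1 + j ∷ []
extE j τ = 2 + j ∷ 1 + j ∷ 4 + j ∷ τ ++ [ 3 + j ]

All-<-+ : ∀ i → All (_≤ k) w → All (_< suc i + k) w
All-<-+ i = All.map (s≤s ∘ m≤n⇒m≤o+n i)

All-≢-+ : ∀ i → All (_≤ k) w → All (suc i + k ≢_) w
All-≢-+ i = All.map (>⇒≢ ∘ s≤s ∘ m≤n⇒m≤o+n i)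

-- An occurrence either misses the final 3 + k, and then lies in the skew sum (2+k)(1+k)(4+k) ⊖ σ, or ends
-- there, which the size of 3 + k relative to the other entries rules out.
Avoiding-extE : InRange k σ → Avoiding σ → Avoiding (extE k σ)
Avoiding-extE {k} {σ} r (σ₁ , σ₂) = ¬2341 ∘ reassoc , ¬1423 ∘ reassoc
  where
  H = 2 + k ∷ 1 + k ∷ 4 + k ∷ []
  reassoc : ∀ {P} → Occurs P (extE k σ) → Occurs P ((H ++ σ) ++ [ 3 + k ])
  reassoc = subst (Occurs _) (sym (++-assoc H σ [ 3 + k ]))
  σ≤k : All (_≤ k) σ
  σ≤k = InRange⇒≤ r
  σ≺H : σ ≺ H
  σ≺H = bounded-≺ σ≤k (m≤n+m _ 1 ∷ ≤-refl ∷ m≤n+m _ 3 ∷ [])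
  H≤ : All (_≤ 4 + k) (H ++ σ)
  H≤ = m≤n+m _ 2 ∷ m≤n+m _ 3 ∷ ≤-refl ∷ All.map (m≤n⇒m≤o+n 4) σ≤k
  ¬2341 : ¬ Occurs P2341 ((H ++ σ) ++ [ 3 + k ])
  ¬2341 o with Occurs-∷ʳ (H ++ σ) o
  ... | inj₁ o′ with P2341-skew σ≺H o′
  ...   | inj₁ o″ = proj₁ Avoiding-short o″
  ...   | inj₂ (inj₁ o″) = σ₁ o″
  ...   | inj₂ (inj₂ (_ ∷ _ ∷ _ ∷ [] , p , a<b , _)) with ⊆-length-≡ p refl
  ...     | refl = <-asym a<b ≤-refl
  ¬2341 o | inj₂ (_ ∷ _ ∷ _ ∷ [] , p , d<a , a<b , _) =
    <⇒≱ a<b (≤-trans (All.lookup H≤ (∈-⊆ p ∈₁)) d<a)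
  ¬2341 o | inj₂ (_ ∷ _ ∷ _ ∷ _ ∷ [] , _ , ())
  ¬2341 o | inj₂ (_ ∷ _ ∷ _ ∷ _ ∷ _ ∷ _ , _ , ())
  ¬1423 : ¬ Occurs P1423 ((H ++ σ) ++ [ 3 + k ])
  ¬1423 o with Occurs-∷ʳ (H ++ σ) o
  ... | inj₁ o′ = [ proj₂ Avoiding-short , σ₂ ]′ (P1423-skew σ≺H o′)
  ... | inj₂ (_ ∷ _ ∷ _ ∷ [] , p , a<c , c<d , d<b) with ⊆-++-split H p
  ...   | [] , _ , refl , _ , p₂ = <⇒≱ d<b (m≤n⇒m≤o+n 3 (All.lookup σ≤k (∈-⊆ p₂ ∈₁)))
  ...   | _ ∷ [] , _ , refl , _ , p₂ = <⇒≱ d<b (m≤n⇒m≤o+n 3 (All.lookup σ≤k (∈-⊆ p₂ ∈₀)))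
  ...   | _ ∷ _ ∷ [] , _ , refl , p₁ , p₂ = <-asym a<c (σ≺H (∈-⊆ p₂ ∈₀) (∈-⊆ p₁ ∈₀))
  ...   | _ ∷ _ ∷ _ ∷ [] , _ , refl , p₁ , _ with ⊆-length-≡ p₁ refl
  ...     | refl = <-asym c<d ≤-refl
  ¬1423 o | inj₂ (_ ∷ _ ∷ _ ∷ _ ∷ [] , _ , ())
  ¬1423 o | inj₂ (_ ∷ _ ∷ _ ∷ _ ∷ _ ∷ _ , _ , ())

module _ {k σ} (ev : Even k) (g : 𝔇 k σ) where

  private
    σ≤k : All (_≤ k) σ
    σ≤k = InRange⇒≤ (inRange g)

  extA-𝔇 : σ ≢ [] → 𝔇 (2 + k) (extA k σ)
  extA-𝔇 σ≢[] = record
    { length≡ = cong (suc ∘ suc) (length≡ g)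
    ; inRange = (z<s , n≤1+n _) ∷ (z<s , ≤-refl) ∷ InRange-+ 2 (inRange g)
    ; unique = Unique-++-≻ (((λ ()) ∷ []) ∷ [] ∷ []) (unique g) σ≺
    ; dumont = DumontStep-odd (Even⇒Odd-suc ev) ≤-refl , Dumont-∷-even (Even-+2 ev) σ≢[] (All-<-+ 1 σ≤k) (dumont g)
    ; avoiding = Avoiding-skew σ≺ Avoiding-short (avoiding g) ¬P123-short
    }
    where
    σ≺ : σ ≺ 1 + k ∷ 2 + k ∷ []
    σ≺ = bounded-≺ σ≤k (≤-refl ∷ n≤1+n _ ∷ [])

  extB-𝔇 : 𝔇 (2 + k) (extB k σ)
  extB-𝔇 = record
    { length≡ = cong suc (length-++-≡ σ [ 1 + k ] (length≡ g))
    ; inRange = (z<s , ≤-refl) ∷ Allₚ.++⁺ (InRange-+ 2 (inRange g)) ((z<s , n≤1+n _) ∷ [])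
    ; unique = Unique-++-≻ ([] ∷ []) (Unique-++-≺ (unique g) ([] ∷ []) σ≺) ≺top
    ; dumont = Dumont-∷-even (Even-+2 ev) (∷ʳ≢[] σ) (Allₚ.++⁺ (All-<-+ 1 σ≤k) (≤-refl ∷ []))
                 (Dumont-++⁺ σ (dumont g) (All-<-+ 0 σ≤k) (Even⇒Odd-suc ev))
    ; avoiding = Avoiding-skew ≺top Avoiding-short (Avoiding-direct σ≺ (avoiding g) Avoiding-short ¬P312-short) ¬P123-short
    }
    where
    σ≺ : σ ≺ [ 1 + k ]
    σ≺ = bounded-≺ σ≤k (≤-refl ∷ [])
    ≺top : σ ++ [ 1 + k ] ≺ [ 2 + k ]
    ≺top = bounded-≺ (Allₚ.++⁺ (All.map m≤n⇒m≤1+n σ≤k) (≤-refl ∷ [])) (≤-refl ∷ [])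

  extC-𝔇 : 𝔇 (2 + k) (extC k σ)
  extC-𝔇 = record
    { length≡ = length-++-≡ σ _ (length≡ g)
    ; inRange = Allₚ.++⁺ (InRange-+ 2 (inRange g)) ((z<s , ≤-refl) ∷ (z<s , n≤1+n _) ∷ [])
    ; unique = Unique-++-≺ (unique g) (((λ ()) ∷ []) ∷ [] ∷ []) σ≺
    ; dumont = Dumont-++⁺ σ (dumont g) (All-<-+ 1 σ≤k) (DumontStep-even (Even-+2 ev) ≤-refl , Even⇒Odd-suc ev)
    ; avoiding = Avoiding-direct σ≺ (avoiding g) Avoiding-short ¬P312-short
    }
    where
    σ≺ : σ ≺ 2 + k ∷ 1 + k ∷ []
    σ≺ = bounded-≺ σ≤k (n≤1+n _ ∷ ≤-refl ∷ [])

  extD-𝔇 : 𝔇 (4 + k) (extD k σ)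
  extD-𝔇 = record
    { length≡ = length-++-≡ σ _ (length≡ g)
    ; inRange = Allₚ.++⁺ (InRange-+ 4 (inRange g))
                  ((z<s , m≤n+m _ 1) ∷ (z<s , ≤-refl) ∷ (z<s , m≤n+m _ 2) ∷ (z<s , m≤n+m _ 3) ∷ [])
    ; unique = Unique-++-≺ (unique g)
                 (((λ ()) ∷ (λ ()) ∷ (λ ()) ∷ []) ∷ ((λ ()) ∷ (λ ()) ∷ []) ∷ ((λ ()) ∷ []) ∷ [] ∷ []) σ≺
    ; dumont = Dumont-++⁺ σ (dumont g) (All-<-+ 2 σ≤k)
                 ( DumontStep-odd (Even⇒Odd-suc (Even-+2 ev)) ≤-refl
                 , DumontStep-even (Even-+2 (Even-+2 ev)) (m≤n+m _ 1)
                 , DumontStep-even (Even-+2 ev) ≤-refl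
                 , Even⇒Odd-suc ev)
    ; avoiding = Avoiding-direct σ≺ (avoiding g) (Avoiding-skew lo≺hi Avoiding-short Avoiding-short ¬P123-short) ¬312
    }
    where
    σ≺ : σ ≺ 3 + k ∷ 4 + k ∷ 2 + k ∷ 1 + k ∷ []
    σ≺ = bounded-≺ σ≤k (m≤n+m _ 2 ∷ m≤n+m _ 3 ∷ m≤n+m _ 1 ∷ ≤-refl ∷ [])
    lo≺hi : 2 + k ∷ 1 + k ∷ [] ≺ 3 + k ∷ 4 + k ∷ []
    lo≺hi = bounded-≺ (≤-refl ∷ n≤1+n _ ∷ []) (≤-refl ∷ n≤1+n _ ∷ [])
    ¬312 : ¬ Occurs P312 (3 + k ∷ 4 + k ∷ 2 + k ∷ 1 + k ∷ [])
    ¬312 o with P312-skew lo≺hi o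
    ... | inj₁ o′ = ¬P312-short o′
    ... | inj₂ (inj₁ o′) = ¬P312-short o′
    ... | inj₂ (inj₂ (_ , _ , p , b<c)) with ⊆-length-≡ p refl
    ...   | refl = <-asym b<c ≤-refl

  extE-𝔇 : 𝔇 (4 + k) (extE k σ)
  extE-𝔇 = record
    { length≡ = cong (suc ∘ suc ∘ suc) (length-++-≡ σ [ 3 + k ] (length≡ g))
    ; inRange = (z<s , m≤n+m _ 2) ∷ (z<s , m≤n+m _ 3) ∷ (z<s , ≤-refl)
              ∷ Allₚ.++⁺ (InRange-+ 4 (inRange g)) ((z<s , m≤n+m _ 1) ∷ [])
    ; unique = ((λ ()) ∷ (λ ()) ∷ Allₚ.++⁺ (All-≢-+ 1 σ≤k) ((λ ()) ∷ []))
             ∷ ((λ ()) ∷ Allₚ.++⁺ (All-≢-+ 0 σ≤k) ((λ ()) ∷ []))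
             ∷ Allₚ.++⁺ (All-≢-+ 3 σ≤k) ((λ ()) ∷ [])
             ∷ Unique-++-≺ (unique g) ([] ∷ []) (bounded-≺ σ≤k (m≤n+m _ 2 ∷ []))
    ; dumont = DumontStep-even (Even-+2 ev) ≤-refl
             , DumontStep-odd (Even⇒Odd-suc ev) (m≤n+m _ 2)
             , Dumont-∷-even (Even-+2 (Even-+2 ev)) (∷ʳ≢[] σ) (Allₚ.++⁺ (All-<-+ 3 σ≤k) (≤-refl ∷ []))
                 (Dumont-++⁺ σ (dumont g) (All-<-+ 2 σ≤k) (Even⇒Odd-suc (Even-+2 ev)))
    ; avoiding = Avoiding-extE (inRange g) (avoiding g)
    }

extA-injective : extA k σ ≡ extA k τ → σ ≡ τ
extA-injective refl = refl

extB-injective : extB k σ ≡ extB k τ → σ ≡ τ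
extB-injective {σ = σ} {τ} eq = ++-cancelʳ _ σ τ (∷-injectiveʳ eq)

extC-injective : extC k σ ≡ extC k τ → σ ≡ τ
extC-injective {σ = σ} {τ} = ++-cancelʳ _ σ τ

extD-injective : extD k σ ≡ extD k τ → σ ≡ τ
extD-injective {σ = σ} {τ} = ++-cancelʳ _ σ τ

extE-injective : extE k σ ≡ extE k τ → σ ≡ τ
extE-injective {σ = σ} {τ} eq = ++-cancelʳ _ σ τ (∷-injectiveʳ (∷-injectiveʳ (∷-injectiveʳ eq)))

-- Decomposition

data Decomposition : ℕ → List ℕ → Set where
  viaA : 𝔇 k σ → σ ≢ [] → Decomposition k (extA k σ)
  viaB : 𝔇 k σ → Decomposition k (extB k σ)
  viaC : 𝔇 k σ → Decomposition k (extC k σ)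
  viaD : 𝔇 k σ → σ ≢ [] → Decomposition (2 + k) (extD k σ)
  viaE : 𝔇 k σ → σ ≢ [] → Decomposition (2 + k) (extE k σ)

below-top : 𝔇 (2 + k) w → x ∈ w → x ≢ 2 + k → x ≢ 1 + k → x ≤ k
below-top g x∈w x≢2+k x≢1+k = ≤∧≢⇒≤pred (≤∧≢⇒≤pred (proj₂ (All.lookup (inRange g) x∈w)) x≢2+k) x≢1+k

-- P holds the largest values in decreasing order, so it starts with k and k − 1; a Dumont word cannot
-- descend from the odd entry k − 1, so P ends there.
top-pair : ∀ {P Q} → Even k → InRange k P → Dumont P → AllPairs _>_ P → Q ≺ P
         → (∀ {v} → 0 < v → v ≤ k → v ∈ P ⊎ v ∈ Q) → P ≢ []
         → ∃ λ j → k ≡ 2 + j × P ≡ 2 + j ∷ 1 + j ∷ []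
top-pair {P = []} _ _ _ _ _ _ P≢[] = contradiction refl P≢[]
top-pair {zero} {_ ∷ _} _ ((0<y , y≤0) ∷ _) _ _ _ _ _ = contradiction y≤0 (<⇒≱ 0<y)
top-pair {1} 2∣1 _ _ _ _ _ _ = contradiction (∣1⇒≡1 2∣1) λ ()
top-pair {suc (suc j)} {y₁ ∷ rest} {Q} ev ((_ , y₁≤) ∷ _) d (y₁>rest ∷ rest↓) Q≺P cover _
  with cover {2 + j} z<s ≤-refl
... | inj₁ (there i) = contradiction y₁≤ (<⇒≱ (All.lookup y₁>rest i))
... | inj₂ i = contradiction y₁≤ (<⇒≱ (Q≺P i ∈₀))
... | inj₁ (here refl) with rest | d | y₁>rest | rest↓ | Q≺P
...   | [] | odd | _ | _ | _ = contradiction ev odd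
...   | y₂ ∷ rest′ | (_ , d₂) | y₂<y₁ ∷ _ | y₂>rest′ ∷ _ | Q≺P′ with cover {1 + j} z<s (n≤1+n _)
...     | inj₁ (here eq) = contradiction eq (<⇒≢ ≤-refl)
...     | inj₁ (there (there i)) = contradiction (≤-pred y₂<y₁) (<⇒≱ (All.lookup y₂>rest′ i))
...     | inj₂ i = contradiction (≤-pred y₂<y₁) (<⇒≱ (Q≺P′ i ∈₁))
...     | inj₁ (there (here refl)) with rest′ | d₂ | y₂>rest′
...       | [] | _ | _ = j , refl , refl
...       | z ∷ _ | (step , _) | z<y₂ ∷ _ =
  contradiction (DumontStep-descent⇒Even step z<y₂) (Even⇒Odd-suc (Even-+2⁻ ev))

module Case-1+k-last {k α β} (g : 𝔇 (2 + k) (α ++ 2 + k ∷ β ++ [ 1 + k ])) where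

  private
    uw = unique g
    β-unique : Unique (2 + k ∷ β ++ [ 1 + k ])
    β-unique = Unique-⊆ (++⁺ˡ α ⊆-refl) uw

  α⊆ : α ⊆ α ++ 2 + k ∷ β ++ [ 1 + k ]
  α⊆ = ++⁺ʳ _ ⊆-refl

  β⊆ : β ⊆ α ++ 2 + k ∷ β ++ [ 1 + k ]
  β⊆ = ++⁺ˡ α (_ ∷ʳ ++⁺ʳ _ ⊆-refl)

  α≤k : All (_≤ k) α
  α≤k = All.tabulate λ i →
    below-top g (∈-⊆ α⊆ i) (Unique-++-≢ α uw i ∈₀) (Unique-++-≢ α uw i (there (∈-++⁺ʳ β ∈₀)))

  β≤k : All (_≤ k) β
  β≤k with β-unique
  ... | 2+k∉ ∷ uβ = All.tabulate λ i →
    below-top g (∈-⊆ β⊆ i) (≢-sym (All.lookup 2+k∉ (∈-++⁺ˡ i))) (Unique-++-≢ β uβ i ∈₀)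

  α++β⊆ : α ++ β ⊆ α ++ 2 + k ∷ β ++ [ 1 + k ]
  α++β⊆ = ++⁺ ⊆-refl (_ ∷ʳ ++⁺ʳ _ ⊆-refl)

  α++β-length : length (α ++ β) ≡ k
  α++β-length = length-++-cancel (α ++ β) [ 1 + k ] (suc-injective (begin
    suc (length ((α ++ β) ++ [ 1 + k ])) ≡⟨ cong (suc ∘ length) (++-assoc α β [ 1 + k ]) ⟩
    suc (length (α ++ β ++ [ 1 + k ]))   ≡⟨ length-++-∷ α ⟨
    length (α ++ 2 + k ∷ β ++ [ 1 + k ]) ≡⟨ length≡ g ⟩
    2 + k                                ∎))
    where open ≡-Reasoning

  α-dumont : Dumont α
  α-dumont = Dumont-++⁻ˡ α (dumont g) (All-<-+ 1 α≤k)

  β-dumont : Dumont β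
  β-dumont = Dumont-++⁻ˡ β (Dumont-tail (Dumont-++⁻ʳ α (dumont g))) (All-<-+ 0 β≤k)

  -- a < b would make a (2+k) b (1+k) an occurrence of 1423.
  β≺α : β ≺ α
  β≺α b∈β a∈α =
    ≮∧≢⇒> (λ a<b → proj₂ (avoiding g) (_ , occurrence , a<b , s≤s (All.lookup β≤k b∈β) , ≤-refl))
          (Unique-++-≢ α uw a∈α (there (∈-++⁺ˡ b∈β)))
    where occurrence = ++⁺ (from∈ a∈α) (refl ∷ ++⁺ (from∈ b∈β) (refl ∷ []))

  -- a₁ < a₂ would make a₁ a₂ (2+k) b an occurrence of 2341, for any b ∈ β.
  α-decreasing : β ≢ [] → AllPairs _>_ α
  α-decreasing β≢[] with ≢[]⇒∈ β≢[]
  ... | b , b∈β = AllPairs-⊆ λ p →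
    ≮∧≢⇒> (λ a₁<a₂ → proj₁ (avoiding g) ( _ , ++⁺ p (refl ∷ ++⁺ʳ _ (from∈ b∈β))
                                          , β≺α b∈β (∈-⊆ p ∈₀) , a₁<a₂ , s≤s (m≤n⇒m≤1+n (All.lookup α≤k (∈-⊆ p ∈₁)))))
          (Unique-pair (Unique-⊆ α⊆ uw) p)

  top-α : Even k → α ≢ [] → β ≢ [] → ∃ λ j → k ≡ 2 + j × α ≡ 2 + j ∷ 1 + j ∷ []
  top-α ev α≢[] β≢[] = top-pair ev (InRange-restrict (inRange g) α⊆ α≤k) α-dumont (α-decreasing β≢[]) β≺α
    (λ 0<v v≤k → ∈-++⁻ α (𝔇-restrict-∈ g α++β⊆ (Allₚ.++⁺ α≤k β≤k) α++β-length 0<v v≤k))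
    α≢[]

module Case-1+k-rises {k α r} (g : 𝔇 (2 + k) (α ++ 1 + k ∷ 2 + k ∷ r)) where

  private
    uw = unique g

  α⊆ : α ⊆ α ++ 1 + k ∷ 2 + k ∷ r
  α⊆ = ++⁺ʳ _ ⊆-refl

  r⊆ : r ⊆ α ++ 1 + k ∷ 2 + k ∷ r
  r⊆ = ++⁺ˡ α (_ ∷ʳ _ ∷ʳ ⊆-refl)

  α≤k : All (_≤ k) α
  α≤k = All.tabulate λ i → below-top g (∈-⊆ α⊆ i) (Unique-++-≢ α uw i ∈₁) (Unique-++-≢ α uw i ∈₀)

  r≤k : All (_≤ k) r
  r≤k with Unique-⊆ (++⁺ˡ α ⊆-refl) uw
  ... | 1+k∉ ∷ 2+k∉ ∷ _ = All.tabulate λ i →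
    below-top g (∈-⊆ r⊆ i) (≢-sym (All.lookup 2+k∉ i)) (≢-sym (All.lookup 1+k∉ (there i)))

  α++r⊆ : α ++ r ⊆ α ++ 1 + k ∷ 2 + k ∷ r
  α++r⊆ = ++⁺ ⊆-refl (_ ∷ʳ _ ∷ʳ ⊆-refl)

  α++r-length : length (α ++ r) ≡ k
  α++r-length = suc-injective (suc-injective (begin
    suc (suc (length (α ++ r)))       ≡⟨ cong suc (length-++-∷ α) ⟨
    suc (length (α ++ 2 + k ∷ r))     ≡⟨ length-++-∷ α ⟨
    length (α ++ 1 + k ∷ 2 + k ∷ r)   ≡⟨ length≡ g ⟩
    2 + k                             ∎))
    where open ≡-Reasoning

  α-dumont : Dumont α
  α-dumont = Dumont-++⁻ˡ α (dumont g) (All-<-+ 0 α≤k)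

  r-dumont : Dumont r
  r-dumont = Dumont-tail (Dumont-tail (Dumont-++⁻ʳ α (dumont g)))

  -- y < a would make a (1+k) (2+k) y an occurrence of 2341.
  α≺r : α ≺ r
  α≺r a∈α y∈r =
    ≮∧≢⇒> (λ y<a → proj₁ (avoiding g) (_ , occurrence , y<a , s≤s (All.lookup α≤k a∈α) , ≤-refl))
          (≢-sym (Unique-++-≢ α uw a∈α (there (there y∈r))))
    where occurrence = ++⁺ (from∈ a∈α) (refl ∷ refl ∷ from∈ y∈r)

  -- r₁ < r₂ would make a (2+k) r₁ r₂ an occurrence of 1423, for any a ∈ α.
  r-decreasing : α ≢ [] → AllPairs _>_ r
  r-decreasing α≢[] with ≢[]⇒∈ α≢[]
  ... | a , a∈α = AllPairs-⊆ λ p →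
    ≮∧≢⇒> (λ r₁<r₂ → proj₂ (avoiding g) ( _ , ++⁺ (from∈ a∈α) (_ ∷ʳ refl ∷ p)
                                          , α≺r a∈α (∈-⊆ p ∈₀) , r₁<r₂ , s≤s (m≤n⇒m≤1+n (All.lookup r≤k (∈-⊆ p ∈₁)))))
          (Unique-pair (Unique-⊆ r⊆ uw) p)

  top-r : Even k → α ≢ [] → r ≢ [] → ∃ λ j → k ≡ 2 + j × r ≡ 2 + j ∷ 1 + j ∷ []
  top-r ev α≢[] r≢[] = top-pair ev (InRange-restrict (inRange g) r⊆ r≤k) r-dumont (r-decreasing α≢[]) α≺r
    (λ 0<v v≤k → swap⊎ (∈-++⁻ α (𝔇-restrict-∈ g α++r⊆ (Allₚ.++⁺ α≤k r≤k) α++r-length 0<v v≤k)))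
    r≢[]

decompose-1+k-last : Even k → 𝔇 (2 + k) (α ++ 2 + k ∷ β ++ [ 1 + k ]) → Decomposition k (α ++ 2 + k ∷ β ++ [ 1 + k ])
decompose-1+k-last {α = []} {β} _ g = viaB (𝔇-restrict g β⊆ β≤k α++β-length β-dumont)
  where open Case-1+k-last {α = []} {β} g
decompose-1+k-last {α = α@(_ ∷ _)} {[]} _ g =
  viaC (𝔇-restrict g α⊆ α≤k (trans (cong length (sym (++-identityʳ α))) α++β-length) α-dumont)
  where open Case-1+k-last {α = α} {[]} g
decompose-1+k-last {α = α@(_ ∷ _)} {β@(_ ∷ _)} ev g with Case-1+k-last.top-α {α = α} {β} g ev (λ ()) (λ ())
... | j , refl , refl =
  viaE (𝔇-restrict g β⊆ (All.tabulate λ i → ≤-pred (β≺α i ∈₁)) (suc-injective (suc-injective α++β-length)) β-dumont)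
       (λ ())
  where open Case-1+k-last {α = α} {β} g

decompose-1+k-rises : Even k → 𝔇 (2 + k) (α ++ 1 + k ∷ 2 + k ∷ r) → Decomposition k (α ++ 1 + k ∷ 2 + k ∷ r)
decompose-1+k-rises {α = α} {[]} ev g = contradiction (Even-+2 ev) (proj₂ (Dumont-++⁻ʳ α (dumont g)))
decompose-1+k-rises {α = []} {r@(_ ∷ _)} _ g = viaA (𝔇-restrict g r⊆ r≤k α++r-length r-dumont) (λ ())
  where open Case-1+k-rises {α = []} {r} g
decompose-1+k-rises {α = α@(_ ∷ _)} {r@(_ ∷ _)} ev g with Case-1+k-rises.top-r {α = α} {r} g ev (λ ()) (λ ())
... | j , refl , refl =
  viaD (𝔇-restrict g α⊆ (All.tabulate λ i → ≤-pred (α≺r i ∈₁)) (length-++-cancel α _ α++r-length) α-dumont) (λ ())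
  where open Case-1+k-rises {α = α} {_} g

-- The odd value 1 + k is last or ascends, and the only larger value is 2 + k.
decompose : Even k → 𝔇 (2 + k) w → Decomposition k w
decompose {k} ev g with ∈-∃++ (𝔇-∈ g z<s (n≤1+n _))
... | α , [] , refl with ∈-++⁻ α (𝔇-∈ g z<s ≤-refl)
...   | inj₂ (here eq) = contradiction eq 1+n≢n
...   | inj₁ 2+k∈α with ∈-∃++ 2+k∈α
...     | α₁ , β , refl = subst (Decomposition k) (sym (++-assoc α₁ _ _))
                            (decompose-1+k-last ev (subst (𝔇 (2 + k)) (++-assoc α₁ _ _) g))
decompose {k} ev g | α , y ∷ r , refl
  with ≤-antisym (proj₂ (All.lookup (inRange g) (∈-++⁺ʳ α ∈₁)))
                 (proj₂ (proj₁ (Dumont-++⁻ʳ α (dumont g))) (Even⇒Odd-suc ev))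
... | refl = decompose-1+k-rises ev g

-- Enumeration

twice : ℕ → ℕ
twice zero = zero
twice (suc n) = 2 + twice n

Even-twice : ∀ n → Even (twice n)
Even-twice zero = 2 ∣0
Even-twice (suc n) = Even-+2 (Even-twice n)

count : ℕ → ℕ
count 0 = 0
count 1 = 1
count (suc (suc n)) = 3 * count (suc n) + 2 * count n

layers : ℕ → List (List ℕ) → ℕ → List (List ℕ) → List (List (List ℕ))
layers k L₁ j L₀ = map (extA k) L₁ ∷ map (extB k) L₁ ∷ map (extC k) L₁ ∷ map (extD j) L₀ ∷ map (extE j) L₀ ∷ []

-- 𝔏 0 is empty although 𝔇¹₀ = {ε}: on the empty seed D and E would repeat A and C (3421 and 2143).
𝔏 : ℕ → List (List ℕ)
𝔏 0 = []
𝔏 1 = [ 2 ∷ 1 ∷ [] ]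
𝔏 (suc (suc n)) = concat (layers (twice (suc n)) (𝔏 (suc n)) (twice n) (𝔏 n))

length-layers : ∀ k L₁ j L₀ → sum (map length (layers k L₁ j L₀)) ≡ 3 * length L₁ + 2 * length L₀
length-layers k L₁ j L₀
  rewrite length-map (extA k) L₁ | length-map (extB k) L₁ | length-map (extC k) L₁
        | length-map (extD j) L₀ | length-map (extE j) L₀ = solve-∀′ (length L₁) (length L₀)
  where
  solve-∀′ : ∀ a b → a + (a + (a + (b + (b + 0)))) ≡ 3 * a + 2 * b
  solve-∀′ = solve-∀

𝔏-length : ∀ n → length (𝔏 n) ≡ count n
𝔏-length 0 = refl
𝔏-length 1 = refl
𝔏-length (suc (suc n)) = begin
  length (𝔏 (suc (suc n)))                           ≡⟨ length-concat (layers _ (𝔏 (suc n)) _ (𝔏 n)) ⟩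
  sum (map length (layers _ (𝔏 (suc n)) _ (𝔏 n)))   ≡⟨ length-layers _ (𝔏 (suc n)) _ (𝔏 n) ⟩
  3 * length (𝔏 (suc n)) + 2 * length (𝔏 n)
    ≡⟨ cong₂ (λ a b → 3 * a + 2 * b) (𝔏-length (suc n)) (𝔏-length n) ⟩
  3 * count (suc n) + 2 * count n                    ∎
  where open ≡-Reasoning

𝔏-sound : ∀ n → All (𝔇 (twice n)) (𝔏 n)
𝔏-sound 0 = []
𝔏-sound 1 = record
  { length≡ = refl
  ; inRange = (z<s , ≤-refl) ∷ (z<s , s≤s z≤n) ∷ []
  ; unique = ((λ ()) ∷ []) ∷ [] ∷ []
  ; dumont = DumontStep-even ∣-refl ≤-refl , Even⇒Odd-suc (2 ∣0)
  ; avoiding = Avoiding-short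
  } ∷ []
𝔏-sound (suc (suc n)) = Allₚ.concat⁺
  ( Allₚ.map⁺ (All.map (λ g → extA-𝔇 ev₁ g (𝔇-nonempty g)) (𝔏-sound (suc n)))
  ∷ Allₚ.map⁺ (All.map (extB-𝔇 ev₁) (𝔏-sound (suc n)))
  ∷ Allₚ.map⁺ (All.map (extC-𝔇 ev₁) (𝔏-sound (suc n)))
  ∷ Allₚ.map⁺ (All.map (extD-𝔇 ev₀) (𝔏-sound n))
  ∷ Allₚ.map⁺ (All.map (extE-𝔇 ev₀) (𝔏-sound n))
  ∷ [])
  where
  ev₁ = Even-twice (suc n)
  ev₀ = Even-twice n

layer-∈-𝔏 : ∀ n → Any (w ∈_) (layers (twice (suc n)) (𝔏 (suc n)) (twice n) (𝔏 n)) → w ∈ 𝔏 (suc (suc n))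
layer-∈-𝔏 _ = ∈-concat⁺

𝔏-complete : ∀ n {w} → 𝔇 (twice n) w → w ≢ [] → w ∈ 𝔏 n
𝔏-complete-decomposition : ∀ n {w} → Decomposition (twice n) w → w ∈ 𝔏 (suc n)

𝔏-complete 0 g w≢[] = contradiction (𝔇₀-empty g) w≢[]
𝔏-complete (suc n) g _ = 𝔏-complete-decomposition n (decompose (Even-twice n) g)

𝔏-complete-decomposition 0 (viaA h σ≢[]) = contradiction (𝔇₀-empty h) σ≢[]
𝔏-complete-decomposition 0 (viaB h) with refl ← 𝔇₀-empty h = here refl
𝔏-complete-decomposition 0 (viaC h) with refl ← 𝔇₀-empty h = here refl
𝔏-complete-decomposition (suc n) (viaA h σ≢[]) = layer-∈-𝔏 n (here (∈-map⁺ _ (𝔏-complete (suc n) h σ≢[])))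
𝔏-complete-decomposition (suc n) (viaB h) = layer-∈-𝔏 n (there (here (∈-map⁺ _ (𝔏-complete (suc n) h (𝔇-nonempty h)))))
𝔏-complete-decomposition (suc n) (viaC h) =
  layer-∈-𝔏 n (there (there (here (∈-map⁺ _ (𝔏-complete (suc n) h (𝔇-nonempty h))))))
𝔏-complete-decomposition (suc n) (viaD h τ≢[]) =
  layer-∈-𝔏 n (there (there (there (here (∈-map⁺ _ (𝔏-complete n h τ≢[]))))))
𝔏-complete-decomposition (suc n) (viaE h τ≢[]) =
  layer-∈-𝔏 n (there (there (there (there (here (∈-map⁺ _ (𝔏-complete n h τ≢[])))))))

𝔏-nonempty : ∀ n → w ∈ 𝔏 n → w ≢ []
𝔏-nonempty (suc n) w∈ = 𝔇-nonempty (All.lookup (𝔏-sound (suc n)) w∈)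

module _ (n : ℕ) where

  private
    k₁ = twice (suc n)
    k₀ = twice n
    ≤k₁ : σ ∈ 𝔏 (suc n) → All (_≤ k₁) σ
    ≤k₁ σ∈ = InRange⇒≤ (inRange (All.lookup (𝔏-sound (suc n)) σ∈))
    ≤k₀ : τ ∈ 𝔏 n → All (_≤ k₀) τ
    ≤k₀ τ∈ = InRange⇒≤ (inRange (All.lookup (𝔏-sound n) τ∈))
    first-C : σ ∈ 𝔏 (suc n) → first (extC k₁ σ) ≤ k₁
    first-C σ∈ = first-++ (≤k₁ σ∈) (𝔏-nonempty (suc n) σ∈)
    first-D : τ ∈ 𝔏 n → first (extD k₀ τ) ≤ k₀
    first-D τ∈ = first-++ (≤k₀ τ∈) (𝔏-nonempty n τ∈)

  -- The layers are told apart by their first entry, except C from D (last entry) and C from E (third entry);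
  -- C and E would overlap on the empty seed.
  layers-disjoint : AllPairs Disjoint (layers k₁ (𝔏 (suc n)) k₀ (𝔏 n))
  layers-disjoint =
      (map-Disjoint A#B ∷ map-Disjoint A#C ∷ map-Disjoint A#D ∷ map-Disjoint A#E ∷ [])
    ∷ (map-Disjoint B#C ∷ map-Disjoint B#D ∷ map-Disjoint B#E ∷ [])
    ∷ (map-Disjoint C#D ∷ map-Disjoint C#E ∷ [])
    ∷ (map-Disjoint D#E ∷ [])
    ∷ [] ∷ []
    where
    A#B : σ ∈ 𝔏 (suc n) → τ ∈ 𝔏 (suc n) → extA k₁ σ ≢ extB k₁ τ
    A#B _ _ eq = <⇒≢ ≤-refl (cong first eq)
    A#C : σ ∈ 𝔏 (suc n) → τ ∈ 𝔏 (suc n) → extA k₁ σ ≢ extC k₁ τ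
    A#C _ τ∈ eq = >⇒≢ (s≤s (first-C τ∈)) (cong first eq)
    A#D : σ ∈ 𝔏 (suc n) → τ ∈ 𝔏 n → extA k₁ σ ≢ extD k₀ τ
    A#D _ τ∈ eq = >⇒≢ (s≤s (m≤n⇒m≤o+n 2 (first-D τ∈))) (cong first eq)
    A#E : σ ∈ 𝔏 (suc n) → τ ∈ 𝔏 n → extA k₁ σ ≢ extE k₀ τ
    A#E _ _ eq = >⇒≢ ≤-refl (cong first eq)
    B#C : σ ∈ 𝔏 (suc n) → τ ∈ 𝔏 (suc n) → extB k₁ σ ≢ extC k₁ τ
    B#C _ τ∈ eq = >⇒≢ (s≤s (m≤n⇒m≤1+n (first-C τ∈))) (cong first eq)
    B#D : σ ∈ 𝔏 (suc n) → τ ∈ 𝔏 n → extB k₁ σ ≢ extD k₀ τ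
    B#D _ τ∈ eq = >⇒≢ (s≤s (m≤n⇒m≤o+n 3 (first-D τ∈))) (cong first eq)
    B#E : σ ∈ 𝔏 (suc n) → τ ∈ 𝔏 n → extB k₁ σ ≢ extE k₀ τ
    B#E _ _ eq = >⇒≢ (n≤1+n _) (cong first eq)
    C#D : σ ∈ 𝔏 (suc n) → τ ∈ 𝔏 n → extC k₁ σ ≢ extD k₀ τ
    C#D {σ} {τ} _ _ eq = >⇒≢ (n≤1+n _) (trans (sym (final-++ σ λ ())) (trans (cong final eq) (final-++ τ λ ())))
    C#E : σ ∈ 𝔏 (suc n) → τ ∈ 𝔏 n → extC k₁ σ ≢ extE k₀ τ
    C#E {σ} {τ} σ∈ τ∈ eq = <⇒≢ (s≤s (m≤n⇒m≤1+n (third-++ (≤k₁ σ∈) σ≥3))) (cong third eq)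
      where
      k₀>0 : 0 < k₀
      k₀>0 = subst (0 <_) (length≡ (All.lookup (𝔏-sound n) τ∈)) (≢[]⇒length>0 (𝔏-nonempty n τ∈))
      σ≥3 : 3 ≤ length σ
      σ≥3 = subst (3 ≤_) (sym (length≡ (All.lookup (𝔏-sound (suc n)) σ∈))) (s≤s (s≤s k₀>0))
    D#E : σ ∈ 𝔏 n → τ ∈ 𝔏 n → extD k₀ σ ≢ extE k₀ τ
    D#E σ∈ _ eq = <⇒≢ (s≤s (m≤n⇒m≤1+n (first-D σ∈))) (cong first eq)

𝔏-unique : ∀ n → Unique (𝔏 n)
𝔏-unique 0 = []
𝔏-unique 1 = [] ∷ []
𝔏-unique (suc (suc n)) = Unique.concat⁺
  ( Unique.map⁺ extA-injective (𝔏-unique (suc n))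
  ∷ Unique.map⁺ extB-injective (𝔏-unique (suc n))
  ∷ Unique.map⁺ extC-injective (𝔏-unique (suc n))
  ∷ Unique.map⁺ extD-injective (𝔏-unique n)
  ∷ Unique.map⁺ extE-injective (𝔏-unique n)
  ∷ [])
  (layers-disjoint n)

-- Permutations as vectors

word : ∀ {m k} → Vec (Fin m) k → List ℕ
word π = tabulate λ i → suc (toℕ (Vec.lookup π i))

word-injective : ∀ {m k} (π π′ : Vec (Fin m) k) → word π ≡ word π′ → π ≡ π′
word-injective Vec.[] Vec.[] _ = refl
word-injective (x Vec.∷ π) (y Vec.∷ π′) eq =
  cong₂ Vec._∷_ (toℕ-injective (suc-injective (∷-injectiveˡ eq))) (word-injective π π′ (∷-injectiveʳ eq))

toFin : 0 < x × x ≤ m → Fin m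
toFin {suc x} (_ , x<m) = fromℕ< x<m

suc-toℕ-toFin : (r : 0 < x × x ≤ m) → suc (toℕ (toFin r)) ≡ x
suc-toℕ-toFin {suc x} (_ , x<m) = cong suc (toℕ-fromℕ< x<m)

toVec : ∀ w → InRange m w → Vec (Fin m) (length w)
toVec [] [] = Vec.[]
toVec (_ ∷ w) (r ∷ rs) = toFin r Vec.∷ toVec w rs

word-toVec : ∀ w (r : InRange m w) → word (toVec w r) ≡ w
word-toVec [] [] = refl
word-toVec (_ ∷ w) (r ∷ rs) = cong₂ _∷_ (suc-toℕ-toFin r) (word-toVec w rs)

fromWord : 𝔇 m w → Vec (Fin m) m
fromWord {m} {w} g = subst (Vec (Fin m)) (length≡ g) (toVec w (inRange g))

word-fromWord : (g : 𝔇 m w) → word (fromWord g) ≡ w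
word-fromWord {m} {w} g = trans (word-subst (length≡ g)) (word-toVec w (inRange g))
  where
  word-subst : ∀ {k₁ k₂} {π : Vec (Fin m) k₁} (eq : k₁ ≡ k₂) → word (subst (Vec (Fin m)) eq π) ≡ word π
  word-subst refl = refl

vectors : ∀ {ws} → All (𝔇 m) ws → List (Vec (Fin m) m)
vectors [] = []
vectors (g ∷ gs) = fromWord g ∷ vectors gs

map-word-vectors : ∀ {ws} (gs : All (𝔇 m) ws) → map word (vectors gs) ≡ ws
map-word-vectors [] = refl
map-word-vectors (g ∷ gs) = cong₂ _∷_ (word-fromWord g) (map-word-vectors gs)

tabulate-Unique⁻ : ∀ {k} (f : Fin k → ℕ) → Unique (tabulate f) → ∀ {i j} → f i ≡ f j → i ≡ j
tabulate-Unique⁻ f (_ ∷ _) {Fin.zero} {Fin.zero} _ = refl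
tabulate-Unique⁻ f (f₀∉ ∷ _) {Fin.zero} {Fin.suc j} eq = contradiction eq (All.lookup f₀∉ (∈-tabulate⁺ j))
tabulate-Unique⁻ f (f₀∉ ∷ _) {Fin.suc i} {Fin.zero} eq = contradiction (sym eq) (All.lookup f₀∉ (∈-tabulate⁺ i))
tabulate-Unique⁻ f (_ ∷ u) {Fin.suc i} {Fin.suc j} eq = cong Fin.suc (tabulate-Unique⁻ (f ∘ Fin.suc) u eq)

DumontCond : ∀ {k} → (Fin k → ℕ) → Set
DumontCond {k} g = ∀ i →
    (Even (g i) → Σ (suc (toℕ i) < k) λ h → g (fromℕ< h) < g i)
  × (Odd (g i) → suc (toℕ i) ≡ k ⊎ Σ (suc (toℕ i) < k) λ h → g i < g (fromℕ< h))

DumontCond-∷ : ∀ {k} {g : Fin (2 + k) → ℕ} →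
               DumontStep (g Fin.zero) (g (Fin.suc Fin.zero)) → DumontCond (g ∘ Fin.suc) → DumontCond g
DumontCond-∷ (even⇒ , odd⇒) _ Fin.zero =
  (λ ev → s≤s (s≤s z≤n) , even⇒ ev) , (λ od → inj₂ (s≤s (s≤s z≤n) , odd⇒ od))
DumontCond-∷ _ c (Fin.suc i) =
  Prod.map (λ even⇒ → Prod.map s≤s id ∘ even⇒) (λ odd⇒ → Sum.map (cong suc) (Prod.map s≤s id) ∘ odd⇒) (c i)

DumontCond-head : ∀ {k} {g : Fin (2 + k) → ℕ} → DumontCond g → DumontStep (g Fin.zero) (g (Fin.suc Fin.zero))
DumontCond-head c = (λ ev → proj₂ (proj₁ (c Fin.zero) ev)) , (λ od → [ (λ ()) , proj₂ ]′ (proj₂ (c Fin.zero) od))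

DumontCond-tail : ∀ {k} {g : Fin (2 + k) → ℕ} → DumontCond g → DumontCond (g ∘ Fin.suc)
DumontCond-tail c i =
  Prod.map (λ even⇒ → Prod.map ≤-pred id ∘ even⇒) (λ odd⇒ → Sum.map suc-injective (Prod.map ≤-pred id) ∘ odd⇒)
           (c (Fin.suc i))

Dumont⇒DumontCond : ∀ {k} (g : Fin k → ℕ) → Dumont (tabulate g) → DumontCond g
Dumont⇒DumontCond {1} g od Fin.zero = flip contradiction od , λ _ → inj₁ refl
Dumont⇒DumontCond {suc (suc k)} g (step , d) = DumontCond-∷ step (Dumont⇒DumontCond (g ∘ Fin.suc) d)

DumontCond⇒Dumont : ∀ {k} (g : Fin k → ℕ) → DumontCond g → Dumont (tabulate g)
DumontCond⇒Dumont {0} g _ = tt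
DumontCond⇒Dumont {1} g c ev = <-irrefl refl (proj₁ (proj₁ (c Fin.zero) ev))
DumontCond⇒Dumont {suc (suc k)} g c = DumontCond-head c , DumontCond⇒Dumont (g ∘ Fin.suc) (DumontCond-tail c)

Increasing : ∀ {r k} → (Fin r → Fin k) → Set
Increasing f = ∀ a b → a Fin.< b → f a Fin.< f b

⊆-tabulate⁻ : ∀ {k} (g : Fin k → ℕ) → s ⊆ tabulate g →
              Σ (Fin (length s) → Fin k) λ f → Increasing f × ∀ a → g (f a) ≡ List.lookup s a
⊆-tabulate⁻ {k = zero} g [] = (λ ()) , (λ ()) , (λ ())
⊆-tabulate⁻ {k = suc k} g (_ ∷ʳ p) with ⊆-tabulate⁻ (g ∘ Fin.suc) p
... | f , f↑ , g∘f≡ = Fin.suc ∘ f , (λ a b a<b → s≤s (f↑ a b a<b)) , g∘f≡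
⊆-tabulate⁻ {s = _ ∷ s} {k = suc k} g (refl ∷ p) with ⊆-tabulate⁻ (g ∘ Fin.suc) p
... | f , f↑ , g∘f≡ = f₀ , f₀↑ , g∘f₀≡
  where
  f₀ : Fin (suc (length s)) → Fin (suc k)
  f₀ Fin.zero = Fin.zero
  f₀ (Fin.suc a) = Fin.suc (f a)
  f₀↑ : Increasing f₀
  f₀↑ Fin.zero (Fin.suc _) _ = z<s
  f₀↑ (Fin.suc a) (Fin.suc b) a<b = s≤s (f↑ a b (≤-pred a<b))
  g∘f₀≡ : ∀ a → g (f₀ a) ≡ List.lookup (g Fin.zero ∷ s) a
  g∘f₀≡ Fin.zero = refl
  g∘f₀≡ (Fin.suc a) = g∘f≡ a

through-suc : ∀ {r k} (f : Fin r → Fin (suc k)) → (∀ a → 0 < toℕ (f a)) →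
              Σ (Fin r → Fin k) λ f′ → ∀ a → f a ≡ Fin.suc (f′ a)
through-suc f pos = (λ a → proj₁ (pred (f a) (pos a))) , (λ a → proj₂ (pred (f a) (pos a)))
  where
  pred : ∀ {k} (i : Fin (suc k)) → 0 < toℕ i → Σ (Fin k) λ j → i ≡ Fin.suc j
  pred (Fin.suc j) _ = j , refl

⊆-tabulate⁺ : ∀ {r k} (g : Fin k → ℕ) (f : Fin r → Fin k) → Increasing f → tabulate (g ∘ f) ⊆ tabulate g
⊆-tabulate-suc : ∀ {r k} (g : Fin (suc k) → ℕ) (f : Fin r → Fin (suc k)) → Increasing f →
                 (∀ a → 0 < toℕ (f a)) → tabulate (g ∘ f) ⊆ tabulate (g ∘ Fin.suc)

⊆-tabulate⁺ {zero} g f _ = []⊆-universal _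
⊆-tabulate⁺ {suc r} {zero} g f _ with () ← f Fin.zero
⊆-tabulate⁺ {suc r} {suc k} g f f↑ with f Fin.zero Fin.≟ Fin.zero
... | yes f₀≡0 = cong g f₀≡0 ∷ ⊆-tabulate-suc g (f ∘ Fin.suc) (λ a b → f↑ (Fin.suc a) (Fin.suc b) ∘ s≤s)
                                 (λ a → subst (λ i → toℕ i < toℕ (f (Fin.suc a))) f₀≡0 (f↑ Fin.zero (Fin.suc a) z<s))
... | no f₀≢0 = _ ∷ʳ ⊆-tabulate-suc g f f↑ (λ a → ≤-trans (nonzero (f Fin.zero) f₀≢0) (f₀≤ a))
  where
  nonzero : ∀ {k} (i : Fin (suc k)) → i ≢ Fin.zero → 0 < toℕ i
  nonzero Fin.zero i≢0 = contradiction refl i≢0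
  nonzero (Fin.suc _) _ = z<s
  f₀≤ : ∀ a → toℕ (f Fin.zero) ≤ toℕ (f a)
  f₀≤ Fin.zero = ≤-refl
  f₀≤ (Fin.suc a) = <⇒≤ (f↑ Fin.zero (Fin.suc a) z<s)

⊆-tabulate-suc g f f↑ pos with through-suc f pos
... | f′ , f≡ = subst (_⊆ _) (tabulate-cong λ a → cong g (sym (f≡ a))) (⊆-tabulate⁺ (g ∘ Fin.suc) f′ f′↑)
  where
  f′↑ : Increasing f′
  f′↑ a b a<b = ≤-pred (subst₂ Fin._<_ (f≡ a) (f≡ b) (f↑ a b a<b))

rank : Vec (Fin 4) 4 → Fin 4 → ℕ
rank p a = toℕ (Vec.lookup p a)

-- Stated with _<ᵇ_ so that, for a concrete pattern, the pairs out of order are refuted by computation.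
OrderedLike : Vec (Fin 4) 4 → (Fin 4 → ℕ) → Set
OrderedLike p v = ∀ a b → T (rank p a <ᵇ rank p b) → v a < v b

record Encodes (P : Pattern) (p : Vec (Fin 4) 4) : Set where
  field
    ordered : ∀ {s} → P s → ∃ λ v → s ≡ tabulate v × OrderedLike p v
    fromOrdered : ∀ {v} → OrderedLike p v → P (tabulate v)
    injective : ∀ a b → Vec.lookup p a ≡ Vec.lookup p b → a ≡ b

lookup-injective? : (p : Vec (Fin 4) 4) → Dec (∀ a b → Vec.lookup p a ≡ Vec.lookup p b → a ≡ b)
lookup-injective? p = all? λ a → all? λ b → (Vec.lookup p a Fin.≟ Vec.lookup p b) →-dec (a Fin.≟ b)

lookup-tabulate₄ : ∀ (v : Fin 4 → ℕ) a → List.lookup (tabulate v) a ≡ v a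
lookup-tabulate₄ v 0F = refl
lookup-tabulate₄ v 1F = refl
lookup-tabulate₄ v 2F = refl
lookup-tabulate₄ v 3F = refl

P2341-ordered : P2341 s → ∃ λ v → s ≡ tabulate v × OrderedLike p2341 v
P2341-ordered {a ∷ b ∷ c ∷ d ∷ []} (d<a , a<b , b<c) = _ , refl , ord
  where
  ord : OrderedLike p2341 (List.lookup (a ∷ b ∷ c ∷ d ∷ []))
  ord 0F 1F _ = a<b
  ord 0F 2F _ = <-trans a<b b<c
  ord 1F 2F _ = b<c
  ord 3F 0F _ = d<a
  ord 3F 1F _ = <-trans d<a a<b
  ord 3F 2F _ = <-trans d<a (<-trans a<b b<c)
  ord _ 3F ()

P1423-ordered : P1423 s → ∃ λ v → s ≡ tabulate v × OrderedLike p1423 v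
P1423-ordered {a ∷ b ∷ c ∷ d ∷ []} (a<c , c<d , d<b) = _ , refl , ord
  where
  ord : OrderedLike p1423 (List.lookup (a ∷ b ∷ c ∷ d ∷ []))
  ord 0F 1F _ = <-trans a<c (<-trans c<d d<b)
  ord 0F 2F _ = a<c
  ord 0F 3F _ = <-trans a<c c<d
  ord 2F 1F _ = <-trans c<d d<b
  ord 2F 3F _ = c<d
  ord 3F 1F _ = d<b
  ord 1F 2F ()
  ord 1F 3F ()
  ord 2F 2F ()
  ord 3F 2F ()
  ord 3F 3F ()

P2341-encodes : Encodes P2341 p2341
P2341-encodes = record
  { ordered = P2341-ordered
  ; fromOrdered = λ o → o 3F 0F tt , o 0F 1F tt , o 1F 2F tt
  ; injective = from-yes (lookup-injective? p2341)
  }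

P1423-encodes : Encodes P1423 p1423
P1423-encodes = record
  { ordered = P1423-ordered
  ; fromOrdered = λ o → o 0F 2F tt , o 2F 3F tt , o 3F 1F tt
  ; injective = from-yes (lookup-injective? p1423)
  }

module _ {P p} (e : Encodes P p) {m} (π : Vec (Fin m) m) where

  open Encodes e

  Contains⇒Occurs : Contains π p → Occurs P (word π)
  Contains⇒Occurs (f , f↑ , ord) =
    _ , ⊆-tabulate⁺ _ f f↑ , fromOrdered λ a b t → s≤s (proj₁ (ord a b) (<ᵇ⇒< _ _ t))

  Occurs⇒Contains : Occurs P (word π) → Contains π p
  Occurs⇒Contains (_ , s⊆ , o) with ordered o
  ... | v , refl , v-ordered with ⊆-tabulate⁻ _ s⊆
  ...   | f , f↑ , f≡ = f , f↑ , λ a b → ≤-pred ∘ πf-ordered a b ∘ <⇒<ᵇ , backward a b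
    where
    πf-ordered : OrderedLike p λ a → suc (toℕ (Vec.lookup π (f a)))
    πf-ordered a b t =
      subst₂ _<_ (sym (trans (f≡ a) (lookup-tabulate₄ v a))) (sym (trans (f≡ b) (lookup-tabulate₄ v b))) (v-ordered a b t)
    backward : ∀ a b → Vec.lookup π (f a) Fin.< Vec.lookup π (f b) → Vec.lookup p a Fin.< Vec.lookup p b
    backward a b πa<πb with <-cmp (rank p a) (rank p b)
    ... | tri< pa<pb _ _ = pa<pb
    ... | tri≈ _ pa≡pb _ with refl ← injective a b (toℕ-injective pa≡pb) = contradiction πa<πb (<-irrefl refl)
    ... | tri> _ _ pb<pa = contradiction (πf-ordered b a (<⇒<ᵇ pb<pa)) (<-asym (s≤s πa<πb))

  Avoids⇔¬Occurs : Avoids π p ⇔ (¬ Occurs P (word π))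
  Avoids⇔¬Occurs = mk⇔ (λ av → av ∘ Occurs⇒Contains) (λ ¬o → ¬o ∘ Contains⇒Occurs)

InD⇔𝔇 : ∀ {m} (π : Vec (Fin m) m) → (IsPerm π × IsDumont1 π × Avoids π p2341 × Avoids π p1423) ⇔ 𝔇 m (word π)
InD⇔𝔇 π = mk⇔
  (λ (perm , dum , av₁ , av₂) → record
    { length≡ = length-tabulate _
    ; inRange = Allₚ.tabulate⁺ λ i → z<s , toℕ<n (Vec.lookup π i)
    ; unique = Unique.tabulate⁺ λ eq → perm _ _ (toℕ-injective (suc-injective eq))
    ; dumont = DumontCond⇒Dumont _ dum
    ; avoiding = Equivalence.to (Avoids⇔¬Occurs P2341-encodes π) av₁ , Equivalence.to (Avoids⇔¬Occurs P1423-encodes π) av₂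
    })
  (λ g → (λ i j eq → tabulate-Unique⁻ _ (unique g) (cong (suc ∘ toℕ) eq))
       , Dumont⇒DumontCond _ (dumont g)
       , Equivalence.from (Avoids⇔¬Occurs P2341-encodes π) (proj₁ (avoiding g))
       , Equivalence.from (Avoids⇔¬Occurs P1423-encodes π) (proj₂ (avoiding g)))

twice≡2* : ∀ n → twice n ≡ 2 * n
twice≡2* zero = refl
twice≡2* (suc n) = trans (cong (suc ∘ suc) (twice≡2* n)) (sym (*-suc 2 n))

permutations : ∀ n → let m = 2 * suc n in
  Σ (List (Vec (Fin m) m)) λ L → Unique L × (∀ π → (π ∈ L) ⇔ InD (suc n) π) × length L ≡ count (suc n)
permutations n = vectors gs , Unique.map⁻ (subst Unique (sym words≡) (𝔏-unique (suc n))) , membership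
               , trans (sym (length-map word (vectors gs))) (trans (cong length words≡) (𝔏-length (suc n)))
  where
  gs : All (𝔇 (2 * suc n)) (𝔏 (suc n))
  gs = subst (λ k → All (𝔇 k) (𝔏 (suc n))) (twice≡2* (suc n)) (𝔏-sound (suc n))
  words≡ : map word (vectors gs) ≡ 𝔏 (suc n)
  words≡ = map-word-vectors gs
  ∈-vectors : (π : Vec (Fin (2 * suc n)) (2 * suc n)) → word π ∈ 𝔏 (suc n) → π ∈ vectors gs
  ∈-vectors π w∈ with ∈-map⁻ word (subst (word π ∈_) (sym words≡) w∈)
  ... | π′ , π′∈ , eq = subst (_∈ vectors gs) (sym (word-injective π π′ eq)) π′∈
  membership : ∀ π → (π ∈ vectors gs) ⇔ InD (suc n) π
  membership π = mk⇔
    (λ π∈ → Equivalence.from (InD⇔𝔇 π) (All.lookup gs (subst (word π ∈_) words≡ (∈-map⁺ word π∈))))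
    (λ inD → ∈-vectors π (𝔏-complete (suc n) (subst (λ k → 𝔇 k (word π)) (sym (twice≡2* (suc n)))
                                                      (Equivalence.to (InD⇔𝔇 π) inD))
                                       λ ()))

-- Powers of 3 ± √17

rat surd : ℕ → ℕ
rat zero = 1
rat (suc n) = 3 * rat n + 17 * surd n
surd zero = 0
surd (suc n) = rat n + 3 * surd n

pos-linear : ∀ a b x y → + (a * x + b * y) ≡ + a ℤ.* + x ℤ.+ + b ℤ.* + y
pos-linear a b x y = trans (ZP.pos-+ (a * x) (b * y)) (cong₂ ℤ._+_ (ZP.pos-* a x) (ZP.pos-* b y))

pos-x+ay : ∀ a x y → + (x + a * y) ≡ + x ℤ.+ + a ℤ.* + y
pos-x+ay a x y = trans (ZP.pos-+ x (a * y)) (cong (ℤ._+_ (+ x)) (ZP.pos-* a y))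

pow-3+√17 : ∀ n → (+ 3 , + 1) ^′ n ≡ (+ rat n , + surd n)
pow-3+√17 zero = refl
pow-3+√17 (suc n) = begin
  (+ 3 , + 1) ⊗ ((+ 3 , + 1) ^′ n)                        ≡⟨ cong ((+ 3 , + 1) ⊗_) (pow-3+√17 n) ⟩
  (+ 3 , + 1) ⊗ (+ rat n , + surd n)
    ≡⟨ cong₂ _,_ (step₁ (+ rat n) (+ surd n)) (step₂ (+ rat n) (+ surd n)) ⟩
  (+ 3 ℤ.* + rat n ℤ.+ + 17 ℤ.* + surd n , + rat n ℤ.+ + 3 ℤ.* + surd n)
    ≡⟨ cong₂ _,_ (pos-linear 3 17 (rat n) (surd n)) (pos-x+ay 3 (rat n) (surd n)) ⟨
  (+ rat (suc n) , + surd (suc n))                         ∎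
  where
  open ≡-Reasoning
  step₁ : ∀ (x y : ℤ) → + 3 ℤ.* x ℤ.+ + 17 ℤ.* + 1 ℤ.* y ≡ + 3 ℤ.* x ℤ.+ + 17 ℤ.* y
  step₁ = ZR.solve-∀
  step₂ : ∀ (x y : ℤ) → + 3 ℤ.* y ℤ.+ + 1 ℤ.* x ≡ x ℤ.+ + 3 ℤ.* y
  step₂ = ZR.solve-∀

pow-3-√17 : ∀ n → (+ 3 , -[1+ 0 ]) ^′ n ≡ (+ rat n , ℤ.- + surd n)
pow-3-√17 zero = refl
pow-3-√17 (suc n) = begin
  (+ 3 , -[1+ 0 ]) ⊗ ((+ 3 , -[1+ 0 ]) ^′ n)               ≡⟨ cong ((+ 3 , -[1+ 0 ]) ⊗_) (pow-3-√17 n) ⟩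
  (+ 3 , -[1+ 0 ]) ⊗ (+ rat n , ℤ.- + surd n)
    ≡⟨ cong₂ _,_ (step₁ (+ rat n) (+ surd n)) (step₂ (+ rat n) (+ surd n)) ⟩
  (+ 3 ℤ.* + rat n ℤ.+ + 17 ℤ.* + surd n , ℤ.- (+ rat n ℤ.+ + 3 ℤ.* + surd n))
    ≡⟨ cong₂ _,_ (pos-linear 3 17 (rat n) (surd n)) (cong ℤ.-_ (pos-x+ay 3 (rat n) (surd n))) ⟨
  (+ rat (suc n) , ℤ.- + surd (suc n))                     ∎
  where
  open ≡-Reasoning
  step₁ : ∀ (x y : ℤ) → + 3 ℤ.* x ℤ.+ + 17 ℤ.* -[1+ 0 ] ℤ.* (ℤ.- y) ≡ + 3 ℤ.* x ℤ.+ + 17 ℤ.* y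
  step₁ = ZR.solve-∀
  step₂ : ∀ (x y : ℤ) → + 3 ℤ.* (ℤ.- y) ℤ.+ -[1+ 0 ] ℤ.* x ≡ ℤ.- (x ℤ.+ + 3 ℤ.* y)
  step₂ = ZR.solve-∀

surd-recurrence : ∀ n → surd (2 + n) ≡ 6 * surd (1 + n) + 8 * surd n
surd-recurrence n = identity (rat n) (surd n)
  where
  identity : ∀ r s → (3 * r + 17 * s) + 3 * (r + 3 * s) ≡ 6 * (r + 3 * s) + 8 * s
  identity = solve-∀

surd-count : ∀ n → surd n + surd n ≡ 2 ^ n * count n
surd-count 0 = refl
surd-count 1 = refl
surd-count (suc (suc n)) = begin
  surd (2 + n) + surd (2 + n)                      ≡⟨ cong (λ x → x + x) (surd-recurrence n) ⟩
  (6 * s₁ + 8 * s₀) + (6 * s₁ + 8 * s₀)            ≡⟨ regroup s₁ s₀ ⟩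
  6 * (s₁ + s₁) + 8 * (s₀ + s₀)
    ≡⟨ cong₂ (λ a b → 6 * a + 8 * b) (surd-count (suc n)) (surd-count n) ⟩
  6 * (2 * 2 ^ n * count (1 + n)) + 8 * (2 ^ n * count n) ≡⟨ regroup′ (2 ^ n) (count (1 + n)) (count n) ⟩
  2 ^ (2 + n) * count (2 + n)                      ∎
  where
  open ≡-Reasoning
  s₁ = surd (1 + n)
  s₀ = surd n
  regroup : ∀ a b → (6 * a + 8 * b) + (6 * a + 8 * b) ≡ 6 * (a + a) + 8 * (b + b)
  regroup = solve-∀
  regroup′ : ∀ t c₁ c₀ → 6 * (2 * t * c₁) + 8 * (t * c₀) ≡ 2 * (2 * t) * (3 * c₁ + 2 * c₀)
  regroup′ = solve-∀

-- N(3 + √17) = −8, so the norm of (3 + √17)ⁿ is ±(2ⁿ)³ with alternating sign.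
Norm : ℕ → ℕ → ℕ → Set
Norm p s t = p * p ≡ 17 * (s * s) + t * t * t ⊎ p * p + t * t * t ≡ 17 * (s * s)

Norm-step : ∀ {p s t} → Norm p s t → Norm (3 * p + 17 * s) (p + 3 * s) (2 * t)
Norm-step {p} {s} {t} (inj₁ p²≡) = inj₂ (+-cancelʳ-≡ (8 * (p * p)) _ _ (begin
  (3 * p + 17 * s) * (3 * p + 17 * s) + 2 * t * (2 * t) * (2 * t) + 8 * (p * p)  ≡⟨ identity p s t ⟩
  17 * ((p + 3 * s) * (p + 3 * s)) + 8 * (17 * (s * s) + t * t * t)
    ≡⟨ cong (λ x → 17 * ((p + 3 * s) * (p + 3 * s)) + 8 * x) p²≡ ⟨
  17 * ((p + 3 * s) * (p + 3 * s)) + 8 * (p * p)                                  ∎))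
  where
  open ≡-Reasoning
  identity : ∀ p s t → (3 * p + 17 * s) * (3 * p + 17 * s) + 2 * t * (2 * t) * (2 * t) + 8 * (p * p)
                     ≡ 17 * ((p + 3 * s) * (p + 3 * s)) + 8 * (17 * (s * s) + t * t * t)
  identity = solve-∀
Norm-step {p} {s} {t} (inj₂ p²+t³≡) = inj₁ (+-cancelʳ-≡ (8 * (17 * (s * s))) _ _ (begin
  (3 * p + 17 * s) * (3 * p + 17 * s) + 8 * (17 * (s * s))
    ≡⟨ cong (λ x → (3 * p + 17 * s) * (3 * p + 17 * s) + 8 * x) p²+t³≡ ⟨
  (3 * p + 17 * s) * (3 * p + 17 * s) + 8 * (p * p + t * t * t)                    ≡⟨ identity p s t ⟩
  17 * ((p + 3 * s) * (p + 3 * s)) + 2 * t * (2 * t) * (2 * t) + 8 * (17 * (s * s)) ∎))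
  where
  open ≡-Reasoning
  identity : ∀ p s t → (3 * p + 17 * s) * (3 * p + 17 * s) + 8 * (p * p + t * t * t)
                     ≡ 17 * ((p + 3 * s) * (p + 3 * s)) + 2 * t * (2 * t) * (2 * t) + 8 * (17 * (s * s))
  identity = solve-∀

norm : ∀ n → Norm (rat n) (surd n) (2 ^ n)
norm zero = inj₁ refl
norm (suc n) = Norm-step {rat n} {surd n} {2 ^ n} (norm n)

surd≤rat : ∀ n → surd n ≤ rat n
surd≤rat zero = z≤n
surd≤rat (suc n) = +-mono-≤ (m≤n*m (rat n) 3) (*-monoˡ-≤ (surd n) (m≤m+n 3 14))

4ⁿ≤4*surd : ∀ n → 2 ^ suc n * 2 ^ suc n ≤ 4 * surd (suc n)
4ⁿ≤4*surd zero = ≤-refl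
4ⁿ≤4*surd (suc n) = begin
  2 ^ suc (suc n) * 2 ^ suc (suc n)  ≡⟨ regroup (2 ^ suc n) ⟩
  4 * (2 ^ suc n * 2 ^ suc n)        ≤⟨ *-monoʳ-≤ 4 (4ⁿ≤4*surd n) ⟩
  4 * (4 * surd (suc n))             ≤⟨ *-monoʳ-≤ 4 (+-monoˡ-≤ (3 * surd (suc n)) (surd≤rat (suc n))) ⟩
  4 * surd (suc (suc n))             ∎
  where
  open ≤-Reasoning
  regroup : ∀ t → 2 * t * (2 * t) ≡ 4 * (t * t)
  regroup = solve-∀

key-bound : ∀ {s t} → 2 ≤ t → t * t ≤ 4 * s → 4 * (t * t * t) + 17 * (t * t) < 68 * (t * s)
key-bound {s} {t@(suc (suc _))} 2≤t@(s≤s (s≤s _)) t²≤4s = begin-strict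
  4 * (t * t * t) + 17 * (t * t)        <⟨ +-monoʳ-< (4 * (t * t * t)) (*-monoˡ-< (t * t) (<ᵇ⇒< 17 26 tt)) ⟩
  4 * (t * t * t) + 26 * (t * t)        ≡⟨ cong (λ x → 4 * (t * t * t) + x) (*-assoc 13 2 (t * t)) ⟩
  4 * (t * t * t) + 13 * (2 * (t * t))  ≤⟨ +-monoʳ-≤ (4 * (t * t * t)) (*-monoʳ-≤ 13 (*-monoˡ-≤ (t * t) 2≤t)) ⟩
  4 * (t * t * t) + 13 * (t * (t * t))  ≡⟨ regroup t ⟩
  17 * (t * (t * t))                    ≤⟨ *-monoʳ-≤ 17 (*-monoʳ-≤ t t²≤4s) ⟩
  17 * (t * (4 * s))                    ≡⟨ regroup′ t s ⟩
  68 * (t * s)                          ∎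
  where
  open ≤-Reasoning
  regroup : ∀ t → 4 * (t * t * t) + 13 * (t * (t * t)) ≡ 17 * (t * (t * t))
  regroup = solve-∀
  regroup′ : ∀ t s → 17 * (t * (4 * s)) ≡ 68 * (t * s)
  regroup′ = solve-∀

Norm⇒≤ : ∀ {p s t} → Norm p s t → p * p ≤ 17 * (s * s) + t * t * t
Norm⇒≤ (inj₁ p²≡) = ≤-reflexive p²≡
Norm⇒≤ {p} {s} {t} (inj₂ p²+t³≡) = ≤-trans (m≤m+n (p * p) (t * t * t)) (≤-trans (≤-reflexive p²+t³≡) (m≤m+n _ _))

Norm⇒≥ : ∀ {p s t} → Norm p s t → 17 * (s * s) ≤ p * p + t * t * t
Norm⇒≥ {p} {s} {t} (inj₁ p²≡) =
  ≤-trans (m≤m+n (17 * (s * s)) (t * t * t)) (≤-trans (≤-reflexive (sym p²≡)) (m≤m+n (p * p) _))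
Norm⇒≥ (inj₂ p²+t³≡) = ≤-reflexive (sym p²+t³≡)

module _ {p s t} (norm-pst : Norm p s t) (bound : 4 * (t * t * t) + 17 * (t * t) < 68 * (t * s)) where

  conjugate-below : 2 * p * (2 * p) < 17 * (t + 2 * s) * (t + 2 * s)
  conjugate-below = begin-strict
    2 * p * (2 * p)                                    ≡⟨ regroup₁ p ⟩
    4 * (p * p)                                        ≤⟨ *-monoʳ-≤ 4 (Norm⇒≤ {p} {s} {t} norm-pst) ⟩
    4 * (17 * (s * s) + t * t * t)                     ≡⟨ regroup₂ s t ⟩
    68 * (s * s) + 4 * (t * t * t)                     <⟨ +-monoʳ-< (68 * (s * s)) 4t³< ⟩
    68 * (s * s) + (17 * (t * t) + 68 * (t * s))       ≡⟨ regroup₃ s t ⟩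
    17 * (t + 2 * s) * (t + 2 * s)                     ∎
    where
    open ≤-Reasoning
    4t³< : 4 * (t * t * t) < 17 * (t * t) + 68 * (t * s)
    4t³< = <-≤-trans (≤-<-trans (m≤m+n (4 * (t * t * t)) (17 * (t * t))) bound) (m≤n+m (68 * (t * s)) (17 * (t * t)))
    regroup₁ : ∀ p → 2 * p * (2 * p) ≡ 4 * (p * p)
    regroup₁ = solve-∀
    regroup₂ : ∀ s t → 4 * (17 * (s * s) + t * t * t) ≡ 68 * (s * s) + 4 * (t * t * t)
    regroup₂ = solve-∀
    regroup₃ : ∀ s t → 68 * (s * s) + (17 * (t * t) + 68 * (t * s)) ≡ 17 * (t + 2 * s) * (t + 2 * s)
    regroup₃ = solve-∀

  conjugate-above : ∀ u → 2 * s ≡ t + u → 17 * u * u < 2 * p * (2 * p)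
  conjugate-above u 2s≡t+u = +-cancelʳ-< (17 * (t * t) + 34 * (t * u)) (17 * u * u) (2 * p * (2 * p)) (begin-strict
    17 * u * u + (17 * (t * t) + 34 * (t * u))        ≡⟨ regroup₁ t u ⟩
    17 * ((t + u) * (t + u))                          ≡⟨ cong (λ x → 17 * (x * x)) 2s≡t+u ⟨
    17 * (2 * s * (2 * s))                            ≡⟨ regroup₂ s ⟩
    4 * (17 * (s * s))                                ≤⟨ *-monoʳ-≤ 4 (Norm⇒≥ {p} {s} {t} norm-pst) ⟩
    4 * (p * p + t * t * t)                           ≡⟨ regroup₃ p t ⟩
    2 * p * (2 * p) + 4 * (t * t * t)                 <⟨ +-monoʳ-< (2 * p * (2 * p)) 4t³< ⟩
    2 * p * (2 * p) + (17 * (t * t) + 34 * (t * u))   ∎)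
    where
    open ≤-Reasoning
    regroup₄ : ∀ t u → 34 * (t * (t + u)) ≡ 17 * (t * t) + (17 * (t * t) + 34 * (t * u))
    regroup₄ = solve-∀
    4t³< : 4 * (t * t * t) < 17 * (t * t) + 34 * (t * u)
    4t³< = +-cancelˡ-< (17 * (t * t)) _ _ (begin-strict
      17 * (t * t) + 4 * (t * t * t)                  ≡⟨ +-comm (17 * (t * t)) _ ⟩
      4 * (t * t * t) + 17 * (t * t)                  <⟨ bound ⟩
      68 * (t * s)                                    ≡⟨ *-assoc 34 2 (t * s) ⟩
      34 * (2 * (t * s))                              ≡⟨ cong (34 *_) (*-comm 2 (t * s)) ⟩
      34 * (t * s * 2)                                ≡⟨ cong (34 *_) (*-assoc t s 2) ⟩
      34 * (t * (s * 2))                              ≡⟨ cong (λ x → 34 * (t * x)) (trans (*-comm s 2) 2s≡t+u) ⟩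
      34 * (t * (t + u))                              ≡⟨ regroup₄ t u ⟩
      17 * (t * t) + (17 * (t * t) + 34 * (t * u))    ∎)
    regroup₁ : ∀ t u → 17 * u * u + (17 * (t * t) + 34 * (t * u)) ≡ 17 * ((t + u) * (t + u))
    regroup₁ = solve-∀
    regroup₂ : ∀ s → 17 * (2 * s * (2 * s)) ≡ 4 * (17 * (s * s))
    regroup₂ = solve-∀
    regroup₃ : ∀ p t → 4 * (p * p + t * t * t) ≡ 2 * p * (2 * p) + 4 * (t * t * t)
    regroup₃ = solve-∀

Pos-neg-pos : ∀ {a b} → 0 < a → a * a < 17 * b * b → Pos (ℤ.- + a , + b)
Pos-neg-pos {suc a} {zero} _ a²<0 = contradiction a²<0 λ ()
Pos-neg-pos {suc a} {suc b} _ a²<17b² = inj₂ (inj₂ (ℤ.-<+ , ℤ.+<+ z<s , ℤ.+<+ a²<17b²))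

Pos-pos : ∀ {a b} → 0 < a → Pos (+ a , + b)
Pos-pos {suc a} _ = inj₁ (ℤ.+≤+ z≤n , ℤ.+≤+ z≤n , λ ())

Pos-pos-neg : ∀ {a u} → 0 < a → 0 < u → 17 * u * u < a * a → Pos (+ a , ℤ.- + u)
Pos-pos-neg {suc a} {suc u} _ _ 17u²<a² = inj₂ (inj₁ (ℤ.+<+ z<s , ℤ.-<+ , ℤ.+<+ 17u²<a²))

-- With c = 4y this is 2(x + y√17) − c√17 = 2(x − y√17), shifted by ±z√17.
conjugate-shift : ∀ (x y z : ℤ) →
    ι z ⊗ √17 ⊖ (ι (+ 2) ⊗ (x , y) ⊖ ι (+ 4 ℤ.* y) ⊗ √17) ≡ (ℤ.- (+ 2 ℤ.* x) , z ℤ.+ + 2 ℤ.* y)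
  × ι z ⊗ √17 ⊕ (ι (+ 2) ⊗ (x , y) ⊖ ι (+ 4 ℤ.* y) ⊗ √17) ≡ (+ 2 ℤ.* x , z ℤ.- + 2 ℤ.* y)
conjugate-shift x y z = cong₂ _,_ (e₁ x y z) (e₂ x y z) , cong₂ _,_ (e₃ x y z) (e₄ x y z)
  where
  e₁ : ∀ (x y z : ℤ) → (z ℤ.* 0ℤ ℤ.+ + 17 ℤ.* 0ℤ ℤ.* + 1)
                       ℤ.- ((+ 2 ℤ.* x ℤ.+ + 17 ℤ.* 0ℤ ℤ.* y) ℤ.- (+ 4 ℤ.* y ℤ.* 0ℤ ℤ.+ + 17 ℤ.* 0ℤ ℤ.* + 1))
                     ≡ ℤ.- (+ 2 ℤ.* x)
  e₁ = ZR.solve-∀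
  e₂ : ∀ (x y z : ℤ) → (z ℤ.* + 1 ℤ.+ 0ℤ ℤ.* 0ℤ) ℤ.- ((+ 2 ℤ.* y ℤ.+ 0ℤ ℤ.* x) ℤ.- (+ 4 ℤ.* y ℤ.* + 1 ℤ.+ 0ℤ ℤ.* 0ℤ))
                     ≡ z ℤ.+ + 2 ℤ.* y
  e₂ = ZR.solve-∀
  e₃ : ∀ (x y z : ℤ) → (z ℤ.* 0ℤ ℤ.+ + 17 ℤ.* 0ℤ ℤ.* + 1)
                       ℤ.+ ((+ 2 ℤ.* x ℤ.+ + 17 ℤ.* 0ℤ ℤ.* y) ℤ.- (+ 4 ℤ.* y ℤ.* 0ℤ ℤ.+ + 17 ℤ.* 0ℤ ℤ.* + 1))
                     ≡ + 2 ℤ.* x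
  e₃ = ZR.solve-∀
  e₄ : ∀ (x y z : ℤ) → (z ℤ.* + 1 ℤ.+ 0ℤ ℤ.* 0ℤ) ℤ.+ ((+ 2 ℤ.* y ℤ.+ 0ℤ ℤ.* x) ℤ.- (+ 4 ℤ.* y ℤ.* + 1 ℤ.+ 0ℤ ℤ.* 0ℤ))
                     ≡ z ℤ.- + 2 ℤ.* y
  e₄ = ZR.solve-∀

AbsLt-conjugate : ∀ {p s t} → 0 < p → Norm p s t → 4 * (t * t * t) + 17 * (t * t) < 68 * (t * s) →
                  AbsLt (ι (+ 2) ⊗ (+ p , + s) ⊖ ι (+ (4 * s)) ⊗ √17) (ι (+ t) ⊗ √17)
AbsLt-conjugate {p} {s} {t} 0<p norm-pst bound = subst Pos (sym Y⊖X≡) lower , subst Pos (sym Y⊕X≡) upper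
  where
  open ≡-Reasoning
  X = ι (+ 2) ⊗ (+ p , + s) ⊖ ι (+ (4 * s)) ⊗ √17
  Y = ι (+ t) ⊗ √17
  X≡ : X ≡ ι (+ 2) ⊗ (+ p , + s) ⊖ ι (+ 4 ℤ.* + s) ⊗ √17
  X≡ = cong (λ c → ι (+ 2) ⊗ (+ p , + s) ⊖ ι c ⊗ √17) (ZP.pos-* 4 s)
  Y⊖X≡ : Y ⊖ X ≡ (ℤ.- + (2 * p) , + (t + 2 * s))
  Y⊖X≡ = begin
    Y ⊖ X                                      ≡⟨ cong (Y ⊖_) X≡ ⟩
    _                                          ≡⟨ proj₁ (conjugate-shift (+ p) (+ s) (+ t)) ⟩
    (ℤ.- (+ 2 ℤ.* + p) , + t ℤ.+ + 2 ℤ.* + s)  ≡⟨ cong₂ _,_ (cong ℤ.-_ (ZP.pos-* 2 p)) (pos-x+ay 2 t s) ⟨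
    (ℤ.- + (2 * p) , + (t + 2 * s))            ∎
  Y⊕X≡ : Y ⊕ X ≡ (+ (2 * p) , + t ℤ.- + (2 * s))
  Y⊕X≡ = begin
    Y ⊕ X                                      ≡⟨ cong (Y ⊕_) X≡ ⟩
    _                                          ≡⟨ proj₂ (conjugate-shift (+ p) (+ s) (+ t)) ⟩
    (+ 2 ℤ.* + p , + t ℤ.- + 2 ℤ.* + s)        ≡⟨ cong₂ (λ a b → (a , + t ℤ.- b)) (ZP.pos-* 2 p) (ZP.pos-* 2 s) ⟨
    (+ (2 * p) , + t ℤ.- + (2 * s))            ∎
  0<2p : 0 < 2 * p
  0<2p = ≤-trans 0<p (m≤m+n p (p + 0))
  lower : Pos (ℤ.- + (2 * p) , + (t + 2 * s))
  lower = Pos-neg-pos 0<2p (conjugate-below {p} {s} {t} norm-pst bound)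
  upper : Pos (+ (2 * p) , + t ℤ.- + (2 * s))
  upper with 2 * s ≤? t
  ... | yes 2s≤t = subst (λ q → Pos (+ (2 * p) , q)) (sym (trans (ZP.m-n≡m⊖n t (2 * s)) (ZP.⊖-≥ 2s≤t))) (Pos-pos 0<2p)
  ... | no 2s≰t = subst (λ q → Pos (+ (2 * p) , q)) (sym (trans (ZP.m-n≡m⊖n t (2 * s)) (ZP.⊖-< t<2s)))
                    (Pos-pos-neg 0<2p (m<n⇒0<n∸m t<2s)
                                 (conjugate-above {p} {s} {t} norm-pst bound _ (sym (m+[n∸m]≡n (<⇒≤ t<2s)))))
    where
    t<2s : t < 2 * s
    t<2s = ≰⇒> 2s≰t

rat>0 : ∀ n → 0 < rat n
rat>0 zero = z<s
rat>0 (suc n) = ≤-trans (rat>0 n) (≤-trans (m≤n*m (rat n) 3) (m≤m+n (3 * rat n) (17 * surd n)))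

binet : ∀ n {c} → c ≡ count n → ι (+ (2 ^ n * c)) ⊗ √17 ≡ ((+ 3 , + 1) ^′ n) ⊖ ((+ 3 , -[1+ 0 ]) ^′ n)
binet n refl = begin
  ι (+ (2 ^ n * count n)) ⊗ √17                      ≡⟨ cong (λ c → ι c ⊗ √17) 2ⁿcₙ≡ ⟩
  ι (+ surd n ℤ.+ + surd n) ⊗ √17                     ≡⟨ cong₂ _,_ (e₁ (+ rat n) (+ surd n)) (e₂ (+ rat n) (+ surd n)) ⟩
  (+ rat n , + surd n) ⊖ (+ rat n , ℤ.- + surd n)    ≡⟨ cong₂ _⊖_ (pow-3+√17 n) (pow-3-√17 n) ⟨
  ((+ 3 , + 1) ^′ n) ⊖ ((+ 3 , -[1+ 0 ]) ^′ n)       ∎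
  where
  open ≡-Reasoning
  2ⁿcₙ≡ : + (2 ^ n * count n) ≡ + surd n ℤ.+ + surd n
  2ⁿcₙ≡ = trans (cong +_ (sym (surd-count n))) (ZP.pos-+ (surd n) (surd n))
  e₁ : ∀ (x y : ℤ) → (y ℤ.+ y) ℤ.* 0ℤ ℤ.+ + 17 ℤ.* 0ℤ ℤ.* + 1 ≡ x ℤ.- x
  e₁ = ZR.solve-∀
  e₂ : ∀ (x y : ℤ) → (y ℤ.+ y) ℤ.* + 1 ℤ.+ 0ℤ ℤ.* 0ℤ ≡ y ℤ.- ℤ.- y
  e₂ = ZR.solve-∀

nearest : ∀ n {c} → c ≡ count (suc n) → let m = suc n in
  AbsLt (ι (+ 2) ⊗ ((+ 3 , + 1) ^′ m) ⊖ ι (+ (2 ^ (m + 1) * c)) ⊗ √17) (ι (+ (2 ^ m)) ⊗ √17)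
nearest n refl = subst₂ (λ x c → AbsLt (ι (+ 2) ⊗ x ⊖ ι (+ c) ⊗ √17) (ι (+ (2 ^ suc n)) ⊗ √17))
  (sym (pow-3+√17 (suc n))) (sym 2ᵐ⁺¹cₘ≡)
  (AbsLt-conjugate {rat (suc n)} {surd (suc n)} {2 ^ suc n} (rat>0 (suc n)) (norm (suc n)) (key-bound 2≤2ᵐ (4ⁿ≤4*surd n)))
  where
  open ≡-Reasoning
  2≤2ᵐ : 2 ≤ 2 ^ suc n
  2≤2ᵐ = *-monoʳ-≤ 2 (m^n>0 2 n)
  2ᵐ⁺¹cₘ≡ : 2 ^ (suc n + 1) * count (suc n) ≡ 4 * surd (suc n)
  2ᵐ⁺¹cₘ≡ = begin
    2 ^ (suc n + 1) * count (suc n)   ≡⟨ cong (λ e → 2 ^ e * count (suc n)) (+-comm (suc n) 1) ⟩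
    2 * 2 ^ suc n * count (suc n)     ≡⟨ *-assoc 2 (2 ^ suc n) (count (suc n)) ⟩
    2 * (2 ^ suc n * count (suc n))   ≡⟨ cong (2 *_) (surd-count (suc n)) ⟨
    2 * (surd (suc n) + surd (suc n)) ≡⟨ double (surd (suc n)) ⟩
    4 * surd (suc n)                  ∎
    where
    double : ∀ s → 2 * (s + s) ≡ 4 * s
    double = solve-∀

theorem3p7 : (n : ℕ) → n ≥ 1 →
    Σ (List (Vec (Fin (2 * n)) (2 * n))) λ L →
      Unique L
      × (∀ π → (π ∈ L) ⇔ InD n π)
      × (ι (+ (2 ^ n * length L)) ⊗ √17 ≡ ((+ 3 , + 1) ^′ n) ⊖ ((+ 3 , -[1+ 0 ]) ^′ n))
      × AbsLt (ι (+ 2) ⊗ ((+ 3 , + 1) ^′ n) ⊖ ι (+ (2 ^ (n Data.Nat.+ 1) * length L)) ⊗ √17) (ι (+ (2 ^ n)) ⊗ √17)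
theorem3p7 (suc n) _ with permutations n
... | L , unique , membership , length≡count =
  L , unique , membership , binet (suc n) length≡count , nearest n length≡count
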